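{- Let $R$ be the ring of size $n\geq 3$ and let $v$ be any starting node. The overhead of Algorithm Ring (described in the context) on $R$ starting at $v$ is: $1$ when $n=3$; $\frac{2n-3}{n}$ when $4\leq n\leq 5$; $\frac{3}{2}$ when $6\leq n\leq 7$; $\frac{2n-2}{n+1}$ when $8\leq n\leq 19$; $\frac{9}{5}$ when $20\leq n\leq 23$; $\frac{2n-1}{n+2}$ when $n\geq 24$.
   Context: Exploration model: a graph $G=(V,E)$ is a simple connected undirected graph whose nodes have distinct labels and in which, at each node of degree $d$, the incident edges are labeled by ports $1,\dots,d$. A mobile agent starts at a node $v$ and has a complete labeled map of $G$ with $v$ marked. A fault configuration is any set $F\subseteq E$ of faulty edges. The agent does not know $F$; it cannot traverse faulty edges, and when it visits a node for the first time it learns which incident ports are faulty (a port is free if its edge is not faulty). Let $C$ be the connected component containing $v$ of the graph $(V,E\setminus F)$. An exploration algorithm (deterministic, not knowing $F$) makes the agent visit all nodes of $C$; exploration is finished when the last node of $C$ is visited (no return is required). The cost $\mathcal{C}(A,F)$ is the number of edge traversals performed. $opt(F)$ is the minimum number of edge traversals needed to visit all nodes of $C$ starting from $v$ by an agent knowing $F$. The overhead of $A$ is $\mathcal{O}_A=\max_{F\subseteq E}\mathcal{C}(A,F)/opt(F)$ (when $C=\{v\}$ both costs are $0$ and the ratio is taken to be $1$). The ring of size $n\geq 3$ has nodes $v_1,\dots,v_n$ and edges $\{v_i,v_{i+1}\}$ ($1\le i\le n-1$) and $\{v_n,v_1\}$; at every node, port $\ell$ leads to its predecessor and port $r$ to its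 successor (predecessor of $v_1$ is $v_n$, successor of $v_n$ is $v_1$). Procedure GO-FIRM($d$), $d\in\{\ell,r\}$: while port $d$ at the current node is free and fewer than $n$ nodes have been visited, take port $d$. Procedure GO-AT-DISTANCE($s,d$): while port $d$ at the current node is free and fewer than $s$ steps have been made in this procedure, take port $d$; then set $b:=$ true if port $d$ at the current node is free and $b:=$ false otherwise. Algorithm Ring: if port $\ell$ at $v$ is faulty, GO-FIRM($r$); else if port $r$ at $v$ is faulty, GO-FIRM($\ell$); else: if $n\le 5$, GO-FIRM($\ell$) then GO-FIRM($r$); if $6\le n\le 19$, GO-AT-DISTANCE($1,\ell$) and then, if $b$, GO-FIRM($r$) followed by GO-FIRM($\ell$), otherwise GO-FIRM($r$); if $n\ge 20$, the same with GO-AT-DISTANCE($2,\ell$) instead of GO-AT-DISTANCE($1,\ell$). (The agent stops as soon as all nodes of $C$ are visited.) -}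

module Defs where

open import Data.Bool using (Bool; true; false; not; _∧_; if_then_else_)
open import Data.Nat using (ℕ; zero; suc; _+_; _*_; _∸_; _≤_; _<ᵇ_; _≤ᵇ_)
open import Data.Fin using (Fin; zero; suc; fromℕ; inject₁; _≟_)
open import Data.Fin.Subset using (Subset)
open import Data.Vec using (lookup)
open import Data.List using (List; []; _∷_; length; take; reverse)
open import Data.List.Membership.Propositional using (_∈_)
open import Data.Maybe using (Maybe; just; nothing; fromMaybe)
import Data.Maybe as Maybe
open import Data.Product using (Σ; ∃; _×_; _,_)
open import Data.Integer using (+_)
open import Data.Rational using (ℚ; _/_; 1ℚ)
  renaming (_≤_ to _≤ℚ_)
open import Relation.Binary.PropositionalEquality using (_≡_)
open import Relation.Nullary.Decidable using (does)

-- The ring of size n.  Nodes v_1..v_n are represented by Fin n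
-- (v_{i+1} ↦ i).  Edge e : Fin n is the edge {e, nxt e}
-- (i.e. {v_i, v_{i+1}} and {v_n, v_1}).

sucC : ∀ {k} → Fin k → Maybe (Fin k)
sucC {suc zero} zero = nothing
sucC {suc (suc _)} zero = just (suc zero)
sucC {suc (suc _)} (suc i) = Maybe.map suc (sucC i)

nxt : ∀ {n} → Fin n → Fin n
nxt {suc _} i = fromMaybe zero (sucC i)

prv : ∀ {n} → Fin n → Fin n
prv {suc k} zero = fromℕ k
prv {suc k} (suc i) = inject₁ i

data Port : Set where
  ℓ r : Port

step : ∀ {n} → Port → Fin n → Fin n
step ℓ i = prv i
step r i = nxt i

edgeOf : ∀ {n} → Port → Fin n → Fin n
edgeOf ℓ i = prv i
edgeOf r i = i

-- A fault configuration is a subset F of the edge set (true = faulty).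
-- Port d at node i is free iff its edge is not in F.
free : ∀ {n} → Subset n → Port → Fin n → Bool
free F d i = not (lookup F (edgeOf d i))

run : ∀ {n} → Subset n → Fin n → List Port → Maybe (List (Fin n))
run F u [] = just (u ∷ [])
run F u (d ∷ ds) with free F d u
... | true = Maybe.map (u ∷_) (run F (step d u) ds)
... | false = nothing

InC : ∀ {n} → Subset n → Fin n → Fin n → Set
InC F v u = Σ (List Port) λ ds → Σ (List _) λ ns → (run F v ds ≡ just ns) × (u ∈ ns)

CoversC : ∀ {n} → Subset n → Fin n → List (Fin n) → Set
CoversC F v ns = ∀ u → InC F v u → u ∈ ns

Explores : ∀ {n} → Subset n → Fin n → List Port → Set
Explores F v ds = Σ (List _) λ ns → (run F v ds ≡ just ns) × CoversC F v ns

IsOpt : ∀ {n} → Subset n → Fin n → ℕ → Set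
IsOpt F v m = (Σ (List Port) λ ds → (length ds ≡ m) × Explores F v ds)
            × (∀ ds → Explores F v ds → m ≤ length ds)

_∈ᵇ_ : ∀ {n} → Fin n → List (Fin n) → Bool
u ∈ᵇ [] = false
u ∈ᵇ (w ∷ ws) = if does (u ≟ w) then true else u ∈ᵇ ws

record State (n : ℕ) : Set where
  constructor st
  field
    pos     : Fin n
    visited : List (Fin n)
    trace   : List (Fin n)   -- nodes entered by the moves, most recent first
open State public

move : ∀ {n} → State n → Port → State n
move (st p vis tr) d =
  let q = step d p in
  st q (if q ∈ᵇ vis then vis else q ∷ vis) (q ∷ tr)

-- GO-FIRM(d), with a fuel bound.  With fuel n the bound is never
-- reached: going in one direction, after n-1 steps all n nodes have
-- been visited and the loop stops by its own condition.
goFirm : ∀ {n} → Subset n → ℕ → Port → State n → State n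
goFirm F zero d s = s
goFirm {n} F (suc f) d s =
  if free F d (pos s) ∧ (length (visited s) <ᵇ n)
  then goFirm F f d (move s d) else s

-- GO-AT-DISTANCE(s, d); the flag b is computed afterwards by the caller
goAtDistance : ∀ {n} → Subset n → ℕ → Port → State n → State n
goAtDistance F zero d s = s
goAtDistance F (suc k) d s =
  if free F d (pos s) then goAtDistance F k d (move s d) else s

-- Final state of Algorithm Ring (ignoring the early stop)
ringAlgState : ∀ {n} → Subset n → Fin n → State n
ringAlgState {n} F v =
  let s0 = st v (v ∷ []) []
      GF = goFirm F n
  in if not (free F ℓ v) then GF r s0
     else if not (free F r v) then GF ℓ s0
     else if n ≤ᵇ 5 then GF r (GF ℓ s0)
     else (let s1 = goAtDistance F (if n ≤ᵇ 19 then 1 else 2) ℓ s0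
           in if free F ℓ (pos s1) then GF ℓ (GF r s1) else GF r s1)

ringAlgTrace : ∀ {n} → Subset n → Fin n → List (Fin n)
ringAlgTrace F v = reverse (trace (ringAlgState F v))

-- Cost C(Ring, F) = c : the agent stops as soon as all nodes of C are
-- visited, i.e. c is the least number of performed moves after which
-- all of C has been visited (and the algorithm does perform c moves).
IsRingCost : ∀ {n} → Subset n → Fin n → ℕ → Set
IsRingCost F v c =
  (c ≤ length (ringAlgTrace F v))
  × CoversC F v (v ∷ take c (ringAlgTrace F v))
  × (∀ c′ → CoversC F v (v ∷ take c′ (ringAlgTrace F v)) → c ≤ c′)

-- cost / opt, taken to be 1 when opt = 0 (i.e. C = {v})
ratio : ℕ → ℕ → ℚ
ratio c zero = 1ℚ
ratio c (suc m) = + c / suc m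

RingOverheadIs : (n : ℕ) → Fin n → ℚ → Set
RingOverheadIs n v q =
  (∀ (F : Subset n) → Σ ℕ λ c → Σ ℕ λ m →
      IsRingCost F v c × IsOpt F v m × (ratio c m ≤ℚ q))
  × (Σ (Subset n) λ F → Σ ℕ λ c → Σ ℕ λ m →
      IsRingCost F v c × IsOpt F v m × (ratio c m ≡ q))

frac : ℕ → ℕ → ℚ
frac a b = + a / suc b

claimedOverhead : ℕ → ℚ
claimedOverhead n =
  if n ≤ᵇ 3 then 1ℚ
  else if n ≤ᵇ 5 then frac (2 * n ∸ 3) (n ∸ 1)          -- (2n-3)/n
  else if n ≤ᵇ 7 then frac 3 1                          -- 3/2
  else if n ≤ᵇ 19 then frac (2 * n ∸ 2) n               -- (2n-2)/(n+1)
  else if n ≤ᵇ 23 then frac 9 4                         -- 9/5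
  else frac (2 * n ∸ 1) (n + 1)                         -- (2n-1)/(n+2)

-- The component of v is either the whole, fault-free ring or an arc of free
-- edges bounded by faulty ones, with v at distance a from its left end and b
-- from its right end.  Exploring such an arc optimally costs a + b + min(a, b),
-- and the walk of Algorithm Ring along it is forced, so its cost is an explicit
-- function ringCost n a b.  The overhead is therefore the largest of the ratios
-- ringCost n a b / (a + b + min(a, b)) over a + b < n, together with the ratio
-- on the fault-free ring.  For n < 24 the maximum is found by evaluation; for
-- larger n, where GO-AT-DISTANCE probes two steps, a case analysis bounds every
-- ratio by (2n - 1)/(n + 2), which is attained at a = 3, b = n - 4.

module Submission where

open import Defs
open import Data.Nat using (ℕ; _≤_)
open import Data.Fin using (Fin)

open import Data.Nat using (zero; suc; _+_; _*_; _∸_; _<_; _⊓_; _≤ᵇ_; _<ᵇ_; pred; NonZero; z≤n; s≤s; s≤s⁻¹)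
import Data.Nat.Properties as NP
open import Data.Nat.DivMod using (_%_)
import Data.Nat.DivMod as DM
open import Data.Nat.Tactic.RingSolver using (solve-∀)
open import Data.Fin using (zero; suc; toℕ; fromℕ; inject₁) renaming (_≟_ to _≟F_)
import Data.Fin.Properties as FP
open import Data.Fin.Subset using (Subset)
open import Data.Vec using (lookup; tabulate)
import Data.Vec.Properties as VP
open import Data.List using (List; []; _∷_; length; take; reverse; map; _++_; replicate; applyUpTo)
import Data.List.Properties as LP
open import Data.List.Membership.Propositional using (_∈_)
import Data.List.Membership.Propositional.Properties as MP
import Data.List.Membership.DecPropositional as DecMembership
open import Data.List.Relation.Unary.Any using (here; there)
import Data.List.Relation.Unary.Any as Any
import Data.List.Relation.Unary.Any.Properties as AnyP
open import Data.List.Relation.Unary.All using (All; []; _∷_)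
import Data.List.Relation.Unary.All as All
open import Data.Maybe using (Maybe; just; nothing)
import Data.Maybe as Maybe
import Data.Maybe.Properties as MaybeP
open import Data.Bool using (Bool; true; false; not; if_then_else_; T)
import Data.Bool.Properties as BP
open import Data.Product using (Σ; _×_; _,_; proj₁; proj₂)
open import Data.Sum using (_⊎_; inj₁; inj₂; [_,_]′)
open import Data.Empty using (⊥-elim)
open import Data.Unit using (⊤; tt)
open import Function.Bundles using (Equivalence)
open import Relation.Nullary using (¬_; Dec; yes; no)
open import Relation.Nullary.Decidable using (does; dec-true; dec-false; toWitness; _×-dec_; _→-dec_)
open import Relation.Binary.PropositionalEquality
open import Data.Integer using (+≤+)
import Data.Integer as ℤ
import Data.Integer.Properties as ℤP
open import Data.Rational using (ℚ) renaming (_≤_ to _≤ℚ_)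
import Data.Rational.Properties as ℚP
import Data.Rational.Unnormalised as U
import Data.Rational.Unnormalised.Properties as UP

-- Ring arithmetic

sucC-just : ∀ {k} (i : Fin (suc k)) → toℕ i < k →
            Σ (Fin (suc k)) λ j → (sucC i ≡ just j) × (toℕ j ≡ suc (toℕ i))
sucC-just {suc k} zero    _         = suc zero , refl , refl
sucC-just {suc k} (suc i) (s≤s i<k) with sucC-just i i<k
... | j , eq , tj rewrite eq = suc j , refl , cong suc tj

sucC-last : ∀ {k} (i : Fin (suc k)) → toℕ i ≡ k → sucC i ≡ nothing
sucC-last {zero}  zero    _  = refl
sucC-last {suc k} (suc i) eq rewrite sucC-last i (NP.suc-injective eq) = refl

toℕ-nxt-< : ∀ {k} (i : Fin (suc k)) → toℕ i < k → toℕ (nxt i) ≡ suc (toℕ i)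
toℕ-nxt-< i i<k with sucC-just i i<k
... | j , eq , tj rewrite eq = tj

nxt-last : ∀ {k} (i : Fin (suc k)) → toℕ i ≡ k → nxt i ≡ zero
nxt-last i eq rewrite sucC-last i eq = refl

toℕ≮⇒last : ∀ {k} (i : Fin (suc k)) → ¬ toℕ i < k → toℕ i ≡ k
toℕ≮⇒last i i≮k = NP.≤-antisym (s≤s⁻¹ (FP.toℕ<n i)) (NP.≮⇒≥ i≮k)

toℕ-nxt : ∀ {k} (i : Fin (suc k)) → toℕ (nxt i) ≡ suc (toℕ i) % suc k
toℕ-nxt {k} i with toℕ i NP.<? k
... | yes i<k = trans (toℕ-nxt-< i i<k) (sym (DM.m<n⇒m%n≡m (s≤s i<k)))
... | no  i≮k = begin
  toℕ (nxt i)      ≡⟨ cong toℕ (nxt-last i (toℕ≮⇒last i i≮k)) ⟩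
  0                ≡⟨ sym (DM.n%n≡0 (suc k)) ⟩
  suc k % suc k    ≡⟨ cong (λ x → suc x % suc k) (sym (toℕ≮⇒last i i≮k)) ⟩
  suc (toℕ i) % suc k ∎
  where open ≡-Reasoning

prv-nxt : ∀ {k} (i : Fin (suc k)) → prv (nxt i) ≡ i
prv-nxt {k} i with toℕ i NP.<? k
... | yes i<k = FP.toℕ-injective (toℕ-prv (nxt i) (toℕ-nxt-< i i<k))
  where toℕ-prv : (j : Fin (suc k)) → toℕ j ≡ suc (toℕ i) → toℕ (prv j) ≡ toℕ i
        toℕ-prv (suc j) eq = trans (FP.toℕ-inject₁ j) (NP.suc-injective eq)
... | no  i≮k rewrite nxt-last i (toℕ≮⇒last i i≮k) =
  FP.toℕ-injective (trans (FP.toℕ-fromℕ k) (sym (toℕ≮⇒last i i≮k)))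

nxt-prv : ∀ {k} (i : Fin (suc k)) → nxt (prv i) ≡ i
nxt-prv {k}     zero    = nxt-last (fromℕ k) (FP.toℕ-fromℕ k)
nxt-prv {suc k} (suc i) = FP.toℕ-injective (begin
  toℕ (nxt (inject₁ i))  ≡⟨ toℕ-nxt-< (inject₁ i) (subst (_< suc k) (sym (FP.toℕ-inject₁ i)) (FP.toℕ<n i)) ⟩
  suc (toℕ (inject₁ i))  ≡⟨ cong suc (FP.toℕ-inject₁ i) ⟩
  suc (toℕ i)            ∎)
  where open ≡-Reasoning

shift : ∀ {n} → ℕ → Fin n → Fin n
shift zero    u = u
shift (suc j) u = nxt (shift j u)

shift-+ : ∀ {n} i j (u : Fin n) → shift (i + j) u ≡ shift i (shift j u)
shift-+ zero    j u = refl
shift-+ (suc i) j u = cong nxt (shift-+ i j u)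

suc-%-% : ∀ m N .{{_ : NonZero N}} → suc (m % N) % N ≡ suc m % N
suc-%-% m N = begin
  suc (m % N) % N          ≡⟨ cong (_% N) (NP.+-comm 1 (m % N)) ⟩
  (m % N + 1) % N          ≡⟨ DM.%-distribˡ-+ (m % N) 1 N ⟩
  (m % N % N + 1 % N) % N  ≡⟨ cong (λ x → (x + 1 % N) % N) (DM.m%n%n≡m%n m N) ⟩
  (m % N + 1 % N) % N      ≡⟨ sym (DM.%-distribˡ-+ m 1 N) ⟩
  (m + 1) % N              ≡⟨ cong (_% N) (NP.+-comm m 1) ⟩
  suc m % N                ∎
  where open ≡-Reasoning

toℕ-shift : ∀ {k} j (u : Fin (suc k)) → toℕ (shift j u) ≡ (toℕ u + j) % suc k
toℕ-shift {k} zero u = begin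
  toℕ u                ≡⟨ sym (DM.m<n⇒m%n≡m (FP.toℕ<n u)) ⟩
  toℕ u % suc k        ≡⟨ cong (_% suc k) (sym (NP.+-identityʳ (toℕ u))) ⟩
  (toℕ u + 0) % suc k  ∎
  where open ≡-Reasoning
toℕ-shift {k} (suc j) u = begin
  toℕ (nxt (shift j u))             ≡⟨ toℕ-nxt (shift j u) ⟩
  suc (toℕ (shift j u)) % suc k     ≡⟨ cong (λ x → suc x % suc k) (toℕ-shift j u) ⟩
  suc ((toℕ u + j) % suc k) % suc k ≡⟨ suc-%-% (toℕ u + j) (suc k) ⟩
  suc (toℕ u + j) % suc k           ≡⟨ cong (_% suc k) (sym (NP.+-suc (toℕ u) j)) ⟩
  (toℕ u + suc j) % suc k           ∎
  where open ≡-Reasoning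

shift-cycle : ∀ {k} (u : Fin (suc k)) → shift (suc k) u ≡ u
shift-cycle {k} u = FP.toℕ-injective (begin
  toℕ (shift (suc k) u)      ≡⟨ toℕ-shift (suc k) u ⟩
  (toℕ u + suc k) % suc k    ≡⟨ DM.[m+n]%n≡m%n (toℕ u) (suc k) ⟩
  toℕ u % suc k              ≡⟨ DM.m<n⇒m%n≡m (FP.toℕ<n u) ⟩
  toℕ u                      ∎)
  where open ≡-Reasoning

+-%-fixed⇒0 : ∀ N .{{_ : NonZero N}} y d → y < N → d < N → (y + d) % N ≡ y → d ≡ 0
+-%-fixed⇒0 N y d y<N d<N eq with (y + d) NP.<? N
... | yes y+d<N = NP.+-cancelˡ-≡ y d 0
      (trans (trans (sym (DM.m<n⇒m%n≡m y+d<N)) eq) (sym (NP.+-identityʳ y)))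
... | no  y+d≮N = ⊥-elim (NP.<-irrefl d≡N d<N)
  where
    N≤y+d : N ≤ y + d
    N≤y+d = NP.≮⇒≥ y+d≮N
    y+d∸N<N : y + d ∸ N < N
    y+d∸N<N = NP.+-cancelʳ-< _ _ N
      (subst (_< N + N) (sym (NP.m∸n+n≡m N≤y+d)) (NP.+-mono-< y<N d<N))
    y+d∸N≡y : y + d ∸ N ≡ y
    y+d∸N≡y = trans (sym (DM.m<n⇒m%n≡m y+d∸N<N)) (trans (DM.m≤n⇒[n∸m]%m≡n%m N≤y+d) eq)
    d≡N : d ≡ N
    d≡N = NP.+-cancelˡ-≡ y d N (trans (sym (NP.m∸n+n≡m N≤y+d)) (cong (_+ N) y+d∸N≡y))

shift-fixed⇒0 : ∀ {k} d (w : Fin (suc k)) → d < suc k → shift d w ≡ w → d ≡ 0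
shift-fixed⇒0 {k} d w d<n eq =
  +-%-fixed⇒0 (suc k) (toℕ w) d (FP.toℕ<n w) d<n (trans (sym (toℕ-shift d w)) (cong toℕ eq))

shift-injective-≤ : ∀ {k} i j (u : Fin (suc k)) → i ≤ j → j < suc k → shift i u ≡ shift j u → i ≡ j
shift-injective-≤ i j u i≤j j<n eq = sym (trans (sym (NP.m∸n+n≡m i≤j)) (cong (_+ i) j∸i≡0))
  where
    j∸i≡0 : j ∸ i ≡ 0
    j∸i≡0 = shift-fixed⇒0 (j ∸ i) (shift i u) (NP.≤-<-trans (NP.m∸n≤m j i) j<n)
      (trans (sym (shift-+ (j ∸ i) i u)) (trans (cong (λ x → shift x u) (NP.m∸n+n≡m i≤j)) (sym eq)))

shift-injective : ∀ {k} i j (u : Fin (suc k)) → i < suc k → j < suc k → shift i u ≡ shift j u → i ≡ j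
shift-injective i j u i<n j<n eq with NP.≤-total i j
... | inj₁ i≤j = shift-injective-≤ i j u i≤j j<n eq
... | inj₂ j≤i = sym (shift-injective-≤ j i u j≤i i<n (sym eq))

shift-surjective : ∀ {k} (u w : Fin (suc k)) → Σ ℕ λ j → (j < suc k) × (shift j u ≡ w)
shift-surjective {k} u w with toℕ u NP.≤? toℕ w
... | yes u≤w = toℕ w ∸ toℕ u , NP.≤-<-trans (NP.m∸n≤m (toℕ w) (toℕ u)) (FP.toℕ<n w) ,
      FP.toℕ-injective (begin
        toℕ (shift (toℕ w ∸ toℕ u) u)       ≡⟨ toℕ-shift _ u ⟩
        (toℕ u + (toℕ w ∸ toℕ u)) % suc k   ≡⟨ cong (_% suc k) (NP.m+[n∸m]≡n u≤w) ⟩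
        toℕ w % suc k                       ≡⟨ DM.m<n⇒m%n≡m (FP.toℕ<n w) ⟩
        toℕ w                               ∎)
  where open ≡-Reasoning
... | no  u≰w = j , j<n , FP.toℕ-injective (begin
        toℕ (shift j u)          ≡⟨ toℕ-shift j u ⟩
        (x + j) % suc k          ≡⟨ cong (_% suc k) x+j≡y+n ⟩
        (y + suc k) % suc k      ≡⟨ DM.[m+n]%n≡m%n y (suc k) ⟩
        y % suc k                ≡⟨ DM.m<n⇒m%n≡m (FP.toℕ<n w) ⟩
        y                        ∎)
  where
    open ≡-Reasoning
    x = toℕ u
    y = toℕ w
    j = suc k ∸ x + y
    x+[n∸x]≡n : x + (suc k ∸ x) ≡ suc k
    x+[n∸x]≡n = NP.m+[n∸m]≡n (NP.<⇒≤ (FP.toℕ<n u))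
    x+j≡n+y : x + j ≡ suc k + y
    x+j≡n+y = trans (sym (NP.+-assoc x (suc k ∸ x) y)) (cong (_+ y) x+[n∸x]≡n)
    x+j≡y+n : x + j ≡ y + suc k
    x+j≡y+n = trans x+j≡n+y (NP.+-comm (suc k) y)
    j<n : j < suc k
    j<n = NP.+-cancelˡ-< x _ _ (subst (_< x + suc k) (sym x+j≡n+y)
            (subst (suc k + y <_) (NP.+-comm (suc k) x) (NP.+-monoʳ-< (suc k) (NP.≰⇒> u≰w))))

-- Walks on the line

stepℕ : Port → ℕ → ℕ
stepℕ ℓ s = pred s
stepℕ r s = suc s

trail : ℕ → List Port → List ℕ
trail s []       = []
trail s (d ∷ ds) = stepℕ d s ∷ trail (stepℕ d s) ds

visits : ℕ → List Port → List ℕ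
visits s ds = s ∷ trail s ds

endpoint : ℕ → List Port → ℕ
endpoint s []       = s
endpoint s (d ∷ ds) = endpoint (stepℕ d s) ds

InRange : ℕ → ℕ → ℕ → Set
InRange lo hi x = lo ≤ x × x ≤ hi

Within : ℕ → ℕ → ℕ → List Port → Set
Within lo hi s []       = ⊤
Within lo hi s (ℓ ∷ ds) = lo < s × Within lo hi (pred s) ds
Within lo hi s (r ∷ ds) = s < hi × Within lo hi (suc s) ds

trail-++ : ∀ s ds es → trail s (ds ++ es) ≡ trail s ds ++ trail (endpoint s ds) es
trail-++ s []       es = refl
trail-++ s (d ∷ ds) es = cong (stepℕ d s ∷_) (trail-++ (stepℕ d s) ds es)

length-trail : ∀ s ds → length (trail s ds) ≡ length ds
length-trail s []       = refl
length-trail s (d ∷ ds) = cong suc (length-trail (stepℕ d s) ds)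

endpoint-++ : ∀ s ds es → endpoint s (ds ++ es) ≡ endpoint (endpoint s ds) es
endpoint-++ s []       es = refl
endpoint-++ s (d ∷ ds) es = endpoint-++ (stepℕ d s) ds es

trail-∷ʳ : ∀ s ds d → trail s (ds ++ d ∷ []) ≡ trail s ds ++ endpoint s (ds ++ d ∷ []) ∷ []
trail-∷ʳ s ds d = trans (trail-++ s ds (d ∷ []))
  (cong (λ z → trail s ds ++ z ∷ []) (sym (endpoint-++ s ds (d ∷ []))))

Within-++ : ∀ {lo hi} s ds es → Within lo hi s ds → Within lo hi (endpoint s ds) es → Within lo hi s (ds ++ es)
Within-++ s []       es _        w = w
Within-++ s (ℓ ∷ ds) es (p , wd) w = p , Within-++ (pred s) ds es wd w
Within-++ s (r ∷ ds) es (p , wd) w = p , Within-++ (suc s) ds es wd w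

Within⇒visits-InRange : ∀ {lo hi} s ds → InRange lo hi s → Within lo hi s ds → All (InRange lo hi) (visits s ds)
Within⇒visits-InRange s       []       s∈ _       = s∈ ∷ []
Within⇒visits-InRange (suc s) (ℓ ∷ ds) s∈ (p , w) =
  s∈ ∷ Within⇒visits-InRange s ds (s≤s⁻¹ p , NP.≤-trans (NP.n≤1+n s) (proj₂ s∈)) w
Within⇒visits-InRange s       (r ∷ ds) s∈ (p , w) =
  s∈ ∷ Within⇒visits-InRange (suc s) ds (NP.≤-trans (proj₁ s∈) (NP.n≤1+n s) , p) w

∈-visits-++ʳ : ∀ {x} s ds es → x ∈ visits (endpoint s ds) es → x ∈ visits s (ds ++ es)
∈-visits-++ʳ s []       es x∈ = x∈
∈-visits-++ʳ s (d ∷ ds) es x∈ = there (∈-visits-++ʳ (stepℕ d s) ds es x∈)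

endpoint-replicate-r : ∀ t s → endpoint s (replicate t r) ≡ t + s
endpoint-replicate-r zero    s = refl
endpoint-replicate-r (suc t) s = trans (endpoint-replicate-r t (suc s)) (NP.+-suc t s)

endpoint-replicate-ℓ : ∀ t q → endpoint (t + q) (replicate t ℓ) ≡ q
endpoint-replicate-ℓ zero    q = refl
endpoint-replicate-ℓ (suc t) q = endpoint-replicate-ℓ t q

Within-replicate-r : ∀ {lo hi} t s → t + s ≤ hi → Within lo hi s (replicate t r)
Within-replicate-r zero    s _  = tt
Within-replicate-r {hi = hi} (suc t) s le =
  NP.≤-trans (s≤s (NP.m≤n+m s t)) le , Within-replicate-r t (suc s) (subst (_≤ hi) (sym (NP.+-suc t s)) le)

Within-replicate-ℓ : ∀ {lo hi} t q → lo ≤ q → Within lo hi (t + q) (replicate t ℓ)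
Within-replicate-ℓ zero    q _     = tt
Within-replicate-ℓ (suc t) q lo≤q = s≤s (NP.≤-trans lo≤q (NP.m≤n+m q t)) , Within-replicate-ℓ t q lo≤q

∈-visits-replicate-r : ∀ t s j → InRange s (t + s) j → j ∈ visits s (replicate t r)
∈-visits-replicate-r t s j (s≤j , j≤t+s) with s NP.≟ j
... | yes refl = here refl
∈-visits-replicate-r zero    s j (s≤j , j≤s)   | no s≢j = ⊥-elim (s≢j (NP.≤-antisym s≤j j≤s))
∈-visits-replicate-r (suc t) s j (s≤j , j≤t+s) | no s≢j =
  there (∈-visits-replicate-r t (suc s) j (NP.≤∧≢⇒< s≤j s≢j , subst (j ≤_) (sym (NP.+-suc t s)) j≤t+s))

∈-visits-replicate-ℓ : ∀ t q j → InRange q (t + q) j → j ∈ visits (t + q) (replicate t ℓ)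
∈-visits-replicate-ℓ t q j (q≤j , j≤t+q) with t + q NP.≟ j
... | yes eq = here (sym eq)
∈-visits-replicate-ℓ zero    q j (q≤j , j≤q)   | no q≢j = ⊥-elim (q≢j (NP.≤-antisym q≤j j≤q))
∈-visits-replicate-ℓ (suc t) q j (q≤j , j≤t+q) | no t+q≢j =
  there (∈-visits-replicate-ℓ t q j (q≤j , s≤s⁻¹ (NP.≤∧≢⇒< j≤t+q (λ eq → t+q≢j (sym eq)))))

visits-≤ : ∀ {x} s ds → x ∈ visits s ds → x ≤ s + length ds
visits-≤ {x} s ds       (here refl) = NP.m≤m+n x (length ds)
visits-≤     s (ℓ ∷ ds) (there x∈)  =
  NP.≤-trans (visits-≤ (pred s) ds x∈) (NP.+-mono-≤ NP.pred[n]≤n (NP.n≤1+n (length ds)))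
visits-≤     s (r ∷ ds) (there x∈)  = NP.≤-trans (visits-≤ (suc s) ds x∈) (NP.≤-reflexive (sym (NP.+-suc s _)))

visits-≥ : ∀ {x} s ds → x ∈ visits s ds → s ≤ x + length ds
visits-≥       s ds       (here refl) = NP.m≤m+n s (length ds)
visits-≥ {x}   zero (ℓ ∷ ds) (there x∈) = z≤n
visits-≥ {x} (suc s) (ℓ ∷ ds) (there x∈) = NP.≤-trans (s≤s (visits-≥ s ds x∈)) (NP.≤-reflexive (sym (NP.+-suc x _)))
visits-≥ {x}   s (r ∷ ds) (there x∈) =
  NP.≤-trans (NP.n≤1+n s) (NP.≤-trans (visits-≥ (suc s) ds x∈) (NP.+-monoʳ-≤ x (NP.n≤1+n _)))

n≤1+pred[n] : ∀ n → n ≤ suc (pred n)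
n≤1+pred[n] zero    = z≤n
n≤1+pred[n] (suc n) = NP.≤-refl

-- According to which end of [0, L] is reached first.
visits-both-ends : ∀ L s ds → s ≤ L → 0 ∈ visits s ds → L ∈ visits s ds →
                   (L + s ≤ length ds) ⊎ (L + (L ∸ s) ≤ length ds)
visits-both-ends L zero ds _ _ L∈ = inj₁ (subst (_≤ length ds) (sym (NP.+-identityʳ L)) (visits-≤ 0 ds L∈))
visits-both-ends L (suc s) ds s≤L 0∈ L∈ with suc s NP.≟ L
... | yes refl = inj₂ (subst (_≤ length ds) (sym (trans (cong (λ z → suc s + z) (NP.n∸n≡0 (suc s))) (NP.+-identityʳ (suc s))))
                   (visits-≥ (suc s) ds 0∈))
visits-both-ends L (suc s) ds       s≤L (here ())  L∈           | no _
visits-both-ends L (suc s) ds       s≤L (there 0∈) (here L≡s)   | no s≢L = ⊥-elim (s≢L (sym L≡s))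
visits-both-ends L (suc s) (ℓ ∷ ds) s≤L (there 0∈) (there L∈)   | no _
  with visits-both-ends L s ds (NP.≤-trans (NP.n≤1+n s) s≤L) 0∈ L∈
... | inj₁ h = inj₁ (NP.≤-trans (NP.≤-reflexive (NP.+-suc L s)) (s≤s h))
... | inj₂ h = inj₂ (NP.≤-trans (NP.+-monoʳ-≤ L (NP.∸-monoʳ-≤ L (NP.n≤1+n s))) (NP.m≤n⇒m≤1+n h))
visits-both-ends L (suc s) (r ∷ ds) s≤L (there 0∈) (there L∈)   | no s≢L
  with visits-both-ends L (suc (suc s)) ds (NP.≤∧≢⇒< s≤L s≢L) 0∈ L∈
... | inj₁ h = inj₁ (NP.≤-trans (NP.+-monoʳ-≤ L (NP.n≤1+n (suc s))) (NP.m≤n⇒m≤1+n h))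
... | inj₂ h = inj₂ (begin
  L + (L ∸ suc s)               ≤⟨ NP.+-monoʳ-≤ L (n≤1+pred[n] (L ∸ suc s)) ⟩
  L + suc (pred (L ∸ suc s))    ≡⟨ cong (λ z → L + suc z) (NP.pred[m∸n]≡m∸[1+n] L (suc s)) ⟩
  L + suc (L ∸ suc (suc s))     ≡⟨ NP.+-suc L _ ⟩
  suc (L + (L ∸ suc (suc s)))   ≤⟨ s≤s h ⟩
  suc (length ds)               ∎)
  where open NP.≤-Reasoning

optArc : ℕ → ℕ → ℕ
optArc a b = a + b + a ⊓ b

optArc-≤ : ∀ a b ds → 0 ∈ visits a ds → a + b ∈ visits a ds → optArc a b ≤ length ds
optArc-≤ a b ds 0∈ L∈ with visits-both-ends (a + b) a ds (NP.m≤m+n a b) 0∈ L∈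
... | inj₁ h = NP.≤-trans (NP.+-monoʳ-≤ (a + b) (NP.m⊓n≤m a b)) h
... | inj₂ h = NP.≤-trans (NP.+-monoʳ-≤ (a + b) (NP.m⊓n≤n a b)) (subst (λ z → a + b + z ≤ length ds) (NP.m+n∸m≡n a b) h)

endpoint-ℓ-++ : ∀ t q es → endpoint (t + q) (replicate t ℓ ++ es) ≡ endpoint q es
endpoint-ℓ-++ t q es = trans (endpoint-++ (t + q) (replicate t ℓ) es) (cong (λ z → endpoint z es) (endpoint-replicate-ℓ t q))

endpoint-r-++ : ∀ t s es → endpoint s (replicate t r ++ es) ≡ endpoint (t + s) es
endpoint-r-++ t s es = trans (endpoint-++ s (replicate t r) es) (cong (λ z → endpoint z es) (endpoint-replicate-r t s))

Within-ℓ-++ : ∀ {lo hi} t q es → lo ≤ q → Within lo hi q es → Within lo hi (t + q) (replicate t ℓ ++ es)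
Within-ℓ-++ t q es lo≤q w = Within-++ (t + q) (replicate t ℓ) es (Within-replicate-ℓ t q lo≤q)
  (subst (λ z → Within _ _ z es) (sym (endpoint-replicate-ℓ t q)) w)

Within-r-++ : ∀ {lo hi} t s es → t + s ≤ hi → Within lo hi (t + s) es → Within lo hi s (replicate t r ++ es)
Within-r-++ t s es t+s≤hi w = Within-++ s (replicate t r) es (Within-replicate-r t s t+s≤hi)
  (subst (λ z → Within _ _ z es) (sym (endpoint-replicate-r t s)) w)

∈-visits-ℓ-++ : ∀ {x} t q es → x ∈ visits q es → x ∈ visits (t + q) (replicate t ℓ ++ es)
∈-visits-ℓ-++ t q es x∈ = ∈-visits-++ʳ (t + q) (replicate t ℓ) es (subst (λ z → _ ∈ visits z es) (sym (endpoint-replicate-ℓ t q)) x∈)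

∈-visits-r-++ : ∀ {x} t s es → x ∈ visits (t + s) es → x ∈ visits s (replicate t r ++ es)
∈-visits-r-++ t s es x∈ = ∈-visits-++ʳ s (replicate t r) es (subst (λ z → _ ∈ visits z es) (sym (endpoint-replicate-r t s)) x∈)

-- Walks on the ring

run-∷-free : ∀ {n} (F : Subset n) w d ds → free F d w ≡ true →
             run F w (d ∷ ds) ≡ Maybe.map (w ∷_) (run F (step d w) ds)
run-∷-free F w d ds fr rewrite fr = refl

run-∷-just : ∀ {n} (F : Subset n) w d ds {ns} → run F w (d ∷ ds) ≡ just ns →
             free F d w ≡ true × Σ (List (Fin n)) λ ns′ → (run F (step d w) ds ≡ just ns′) × (ns ≡ w ∷ ns′)
run-∷-just F w d ds eq with free F d w
... | false with eq
...   | ()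
run-∷-just F w d ds eq | true with run F (step d w) ds
... | just ns′ = refl , ns′ , refl , sym (MaybeP.just-injective eq)
... | nothing with eq
...   | ()

faulty⇒¬free : ∀ {n} (F : Subset n) d w → lookup F (edgeOf d w) ≡ true → free F d w ≢ true
faulty⇒¬free F d w faulty fr rewrite faulty with fr
... | ()

length-run : ∀ {n} (F : Subset n) w ds {ns} → run F w ds ≡ just ns → length ns ≡ suc (length ds)
length-run F w []       refl = refl
length-run F w (d ∷ ds) eq with run-∷-just F w d ds eq
... | _ , ns′ , eq′ , refl = cong suc (length-run F (step d w) ds eq′)

module ArcWalks {k : ℕ} (F : Subset (suc k)) (u : Fin (suc k)) where

  node : ℕ → Fin (suc k)
  node j = shift j u

  FreeUpTo : ℕ → Set
  FreeUpTo L = ∀ j → j < L → lookup F (node j) ≡ false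

  step-ℓ-node : ∀ j → step ℓ (node (suc j)) ≡ node j
  step-ℓ-node j = prv-nxt (node j)

  free-ℓ-node : ∀ j → free F ℓ (node (suc j)) ≡ not (lookup F (node j))
  free-ℓ-node j = cong (λ z → not (lookup F z)) (step-ℓ-node j)

  run-Within : ∀ L s ds → FreeUpTo L → s ≤ L → Within 0 L s ds →
               run F (node s) ds ≡ just (map node (visits s ds))
  run-Within L s       []       _    _   _       = refl
  run-Within L (suc s) (ℓ ∷ ds) fr≤L s≤L (_ , w)
    rewrite run-∷-free F (node (suc s)) ℓ ds (trans (free-ℓ-node s) (cong not (fr≤L s s≤L)))
          | step-ℓ-node s
          | run-Within L s ds fr≤L (NP.≤-trans (NP.n≤1+n s) s≤L) w = refl
  run-Within L s       (r ∷ ds) fr≤L _   (s<L , w)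
    rewrite run-∷-free F (node s) r ds (cong not (fr≤L s s<L))
          | run-Within L (suc s) ds fr≤L s<L w = refl

  run-confined : ∀ L s ds {ns} → lookup F (prv (node 0)) ≡ true → lookup F (node L) ≡ true →
                 s ≤ L → run F (node s) ds ≡ just ns → Within 0 L s ds × (ns ≡ map node (visits s ds))
  run-confined L s [] _ _ _ eq = tt , sym (MaybeP.just-injective eq)
  run-confined L s (d ∷ ds) h₀ h_L s≤L eq with run-∷-just F (node s) d ds eq
  run-confined L zero (ℓ ∷ ds) h₀ h_L s≤L eq | fr , _ = ⊥-elim (faulty⇒¬free F ℓ (node 0) h₀ fr)
  run-confined L (suc s) (ℓ ∷ ds) h₀ h_L s≤L eq | _ , ns′ , eq′ , refl
    with run-confined L s ds h₀ h_L (NP.≤-trans (NP.n≤1+n s) s≤L) (subst (λ w → run F w ds ≡ just ns′) (step-ℓ-node s) eq′)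
  ... | w , refl = (s≤s z≤n , w) , refl
  run-confined L s (r ∷ ds) h₀ h_L s≤L eq | fr , ns′ , eq′ , refl with s NP.<? L
  ... | no s≮L = ⊥-elim (faulty⇒¬free F r (node s) (subst (λ z → lookup F (node z) ≡ true) (sym s≡L) h_L) fr)
    where s≡L = NP.≤-antisym s≤L (NP.≮⇒≥ s≮L)
  ... | yes s<L with run-confined L (suc s) ds h₀ h_L s<L eq′
  ...   | w , refl = (s<L , w) , refl

sweepℓr : ℕ → ℕ → List Port
sweepℓr p q = replicate p ℓ ++ replicate q r

sweeprℓ : ℕ → ℕ → List Port
sweeprℓ a b = replicate b r ++ replicate (a + b) ℓ

length-sweepℓr : ∀ p q → length (sweepℓr p q) ≡ p + q
length-sweepℓr p q = trans (LP.length-++ (replicate p ℓ)) (cong₂ _+_ (LP.length-replicate p) (LP.length-replicate q))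

length-sweeprℓ : ∀ a b → length (sweeprℓ a b) ≡ b + (a + b)
length-sweeprℓ a b = trans (LP.length-++ (replicate b r)) (cong₂ _+_ (LP.length-replicate b) (LP.length-replicate (a + b)))

endpoint-sweepℓr : ∀ p q → endpoint p (sweepℓr p q) ≡ q
endpoint-sweepℓr p q = begin
  endpoint p (sweepℓr p q)          ≡⟨ cong (λ z → endpoint z (sweepℓr p q)) (sym (NP.+-identityʳ p)) ⟩
  endpoint (p + 0) (sweepℓr p q)    ≡⟨ endpoint-ℓ-++ p 0 (replicate q r) ⟩
  endpoint 0 (replicate q r)        ≡⟨ endpoint-replicate-r q 0 ⟩
  q + 0                             ≡⟨ NP.+-identityʳ q ⟩
  q                                 ∎
  where open ≡-Reasoning

Within-sweepℓr : ∀ {hi} p q → p ≤ hi → q ≤ hi → Within 0 hi p (sweepℓr p q)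
Within-sweepℓr p q p≤hi q≤hi = subst (λ z → Within 0 _ z (sweepℓr p q)) (NP.+-identityʳ p)
  (Within-ℓ-++ p 0 (replicate q r) z≤n (Within-replicate-r q 0 (subst (_≤ _) (sym (NP.+-identityʳ q)) q≤hi)))

∈-visits-sweepℓr : ∀ p q j → j ≤ q → j ∈ visits p (sweepℓr p q)
∈-visits-sweepℓr p q j j≤q = subst (λ z → j ∈ visits z (sweepℓr p q)) (NP.+-identityʳ p)
  (∈-visits-ℓ-++ p 0 (replicate q r) (∈-visits-replicate-r q 0 j (z≤n , subst (j ≤_) (sym (NP.+-identityʳ q)) j≤q)))

Within-sweeprℓ : ∀ a b → Within 0 (a + b) a (sweeprℓ a b)
Within-sweeprℓ a b = Within-r-++ b a _ (NP.≤-reflexive (NP.+-comm b a))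
  (subst (λ z → Within 0 (a + b) z (replicate (a + b) ℓ)) (trans (NP.+-identityʳ (a + b)) (NP.+-comm a b))
    (Within-replicate-ℓ (a + b) 0 z≤n))

∈-visits-sweeprℓ : ∀ a b j → j ≤ a + b → j ∈ visits a (sweeprℓ a b)
∈-visits-sweeprℓ a b j j≤L = ∈-visits-r-++ b a _
  (subst (λ z → j ∈ visits z (replicate (a + b) ℓ)) (trans (NP.+-identityʳ (a + b)) (NP.+-comm a b))
    (∈-visits-replicate-ℓ (a + b) 0 j (z≤n , subst (j ≤_) (sym (NP.+-identityʳ (a + b))) j≤L)))

endpoint-sweeprℓ : ∀ a b → endpoint a (sweeprℓ a b) ≡ 0
endpoint-sweeprℓ a b = begin
  endpoint a (sweeprℓ a b)                       ≡⟨ endpoint-r-++ b a _ ⟩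
  endpoint (b + a) (replicate (a + b) ℓ)         ≡⟨ cong (λ z → endpoint z (replicate (a + b) ℓ)) (NP.+-comm b a) ⟩
  endpoint (a + b) (replicate (a + b) ℓ)         ≡⟨ cong (λ z → endpoint z (replicate (a + b) ℓ)) (sym (NP.+-identityʳ (a + b))) ⟩
  endpoint (a + b + 0) (replicate (a + b) ℓ)     ≡⟨ endpoint-replicate-ℓ (a + b) 0 ⟩
  0                                              ∎
  where open ≡-Reasoning

replicate-∷ʳ : ∀ {A : Set} n (x : A) → replicate (suc n) x ≡ replicate n x ++ x ∷ []
replicate-∷ʳ zero    x = refl
replicate-∷ʳ (suc n) x = cong (x ∷_) (replicate-∷ʳ n x)

sweepℓr-∷ʳ : ∀ p q → sweepℓr p (suc q) ≡ sweepℓr p q ++ r ∷ []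
sweepℓr-∷ʳ p q = trans (cong (replicate p ℓ ++_) (replicate-∷ʳ q r)) (sym (LP.++-assoc (replicate p ℓ) (replicate q r) (r ∷ [])))

Within-suc : ∀ {lo hi} s ds → Within lo hi s ds → Within (suc lo) (suc hi) (suc s) ds
Within-suc s       []       _       = tt
Within-suc (suc s) (ℓ ∷ ds) (p , w) = s≤s p , Within-suc s ds w
Within-suc s       (r ∷ ds) (p , w) = s≤s p , Within-suc (suc s) ds w

sweeprℓ-∷ʳ : ∀ x y → sweeprℓ (suc x) y ≡ sweeprℓ x y ++ ℓ ∷ []
sweeprℓ-∷ʳ x y = trans (cong (replicate y r ++_) (replicate-∷ʳ (x + y) ℓ))
  (sym (LP.++-assoc (replicate y r) (replicate (x + y) ℓ) (ℓ ∷ [])))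

probe-sweep : ℕ → ℕ → ℕ → List Port
probe-sweep κ x y = replicate κ ℓ ++ sweeprℓ x y

length-probe-sweep : ∀ κ x y → length (probe-sweep κ x y) ≡ κ + (y + (x + y))
length-probe-sweep κ x y = trans (LP.length-++ (replicate κ ℓ)) (cong₂ _+_ (LP.length-replicate κ) (length-sweeprℓ x y))

endpoint-probe-sweep : ∀ κ x y → endpoint (κ + x) (probe-sweep κ x y) ≡ 0
endpoint-probe-sweep κ x y = trans (endpoint-ℓ-++ κ x (sweeprℓ x y)) (endpoint-sweeprℓ x y)

∈-visits-probe-sweep : ∀ κ x y j → j ≤ x + y → j ∈ visits (κ + x) (probe-sweep κ x y)
∈-visits-probe-sweep κ x y j j≤ = ∈-visits-ℓ-++ κ x (sweeprℓ x y) (∈-visits-sweeprℓ x y j j≤)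

probe-sweep-∷ʳ : ∀ κ x y → probe-sweep κ (suc x) y ≡ probe-sweep κ x y ++ ℓ ∷ []
probe-sweep-∷ʳ κ x y = trans (cong (replicate κ ℓ ++_) (sweeprℓ-∷ʳ x y))
  (sym (LP.++-assoc (replicate κ ℓ) (sweeprℓ x y) (ℓ ∷ [])))

Within-probe-sweep : ∀ κ x y → Within 1 (suc x + y) (κ + suc x) (probe-sweep κ x y)
Within-probe-sweep κ x y = Within-ℓ-++ κ (suc x) (sweeprℓ x y) (s≤s z≤n) (Within-suc x (sweeprℓ x y) (Within-sweeprℓ x y))

-- Components and optimal exploration

n≤length-of-complete : ∀ {n} (xs : List (Fin n)) → (∀ w → w ∈ xs) → n ≤ length xs
n≤length-of-complete {n} xs complete with length xs NP.<? n
... | no  len≮n = NP.≮⇒≥ len≮n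
... | yes len<n with FP.pigeonhole len<n (λ w → Any.index (complete w))
...   | i , j , i<j , same-index = ⊥-elim (NP.<-irrefl (cong toℕ i≡j) i<j)
  where i≡j : i ≡ j
        i≡j = trans (AnyP.lookup-index (complete i))
                (trans (cong (Data.List.lookup xs) same-index) (sym (AnyP.lookup-index (complete j))))

-- When L = n - 1 the two faulty edges are one and the same.
record IsComponentArc {k : ℕ} (F : Subset (suc k)) (u : Fin (suc k)) (L : ℕ) : Set where
  field
    L<n          : L < suc k
    free-inner   : ArcWalks.FreeUpTo F u L
    faulty-left  : lookup F (prv u) ≡ true
    faulty-right : lookup F (shift L u) ≡ true

module Arc {k : ℕ} {F : Subset (suc k)} {u : Fin (suc k)} (a b : ℕ) (arc : IsComponentArc F u (a + b)) where
  open ArcWalks F u public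
  open IsComponentArc arc public

  L : ℕ
  L = a + b

  a≤L : a ≤ L
  a≤L = NP.m≤m+n a b

  ∈-map-node⁻ : ∀ {xs} j → j ≤ L → All (_≤ L) xs → node j ∈ map node xs → j ∈ xs
  ∈-map-node⁻ j j≤L xs≤L j∈ with MP.∈-map⁻ node j∈
  ... | x , x∈ , eq = subst (_∈ _)
    (sym (shift-injective j x u (NP.≤-<-trans j≤L L<n) (NP.≤-<-trans (All.lookup xs≤L x∈) L<n) eq)) x∈

  Within⇒visits-≤L : ∀ s ds → s ≤ L → Within 0 L s ds → All (_≤ L) (visits s ds)
  Within⇒visits-≤L s ds s≤L w = All.map proj₂ (Within⇒visits-InRange s ds (z≤n , s≤L) w)

  InC-node⁻ : ∀ s w → s ≤ L → InC F (node s) w → Σ ℕ λ j → (j ≤ L) × (w ≡ node j)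
  InC-node⁻ s w s≤L (ds , ns , eq , w∈) with run-confined L s ds faulty-left faulty-right s≤L eq
  ... | within , refl with MP.∈-map⁻ node w∈
  ...   | x , x∈ , w≡ = x , All.lookup (Within⇒visits-≤L s ds s≤L within) x∈ , w≡

  run-sweepℓr : ∀ s → s ≤ L → run F (node s) (sweepℓr s L) ≡ just (map node (visits s (sweepℓr s L)))
  run-sweepℓr s s≤L = run-Within L s (sweepℓr s L) free-inner s≤L (Within-sweepℓr s L s≤L NP.≤-refl)

  InC-node : ∀ s j → s ≤ L → j ≤ L → InC F (node s) (node j)
  InC-node s j s≤L j≤L = sweepℓr s L , _ , run-sweepℓr s s≤L , MP.∈-map⁺ node (∈-visits-sweepℓr s L j j≤L)

  covers-arc : ∀ s ds → s ≤ L → (∀ j → j ≤ L → j ∈ visits s ds) → CoversC F (node s) (map node (visits s ds))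
  covers-arc s ds s≤L covers w w∈C with InC-node⁻ s w s≤L w∈C
  ... | j , j≤L , refl = MP.∈-map⁺ node (covers j j≤L)

  explores-arc : ∀ ds → Within 0 L a ds → (∀ j → j ≤ L → j ∈ visits a ds) → Explores F (node a) ds
  explores-arc ds w covers = _ , run-Within L a ds free-inner a≤L w , covers-arc a ds a≤L covers

  isOpt : IsOpt F (node a) (optArc a b)
  isOpt = optimal-walk , lower-bound
    where
      optimal-walk : Σ (List Port) λ ds → (length ds ≡ optArc a b) × Explores F (node a) ds
      optimal-walk with a NP.≤? b
      ... | yes a≤b = sweepℓr a L , length≡ ,
            explores-arc (sweepℓr a L) (Within-sweepℓr a L a≤L NP.≤-refl) (∈-visits-sweepℓr a L)
        where length≡ : length (sweepℓr a L) ≡ optArc a b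
              length≡ = trans (length-sweepℓr a L) (trans (NP.+-comm a L) (cong (L +_) (sym (NP.m≤n⇒m⊓n≡m a≤b))))
      ... | no  a≰b = sweeprℓ a b , length≡ , explores-arc (sweeprℓ a b) (Within-sweeprℓ a b) (∈-visits-sweeprℓ a b)
        where length≡ : length (sweeprℓ a b) ≡ optArc a b
              length≡ = trans (length-sweeprℓ a b)
                (trans (NP.+-comm b L) (cong (L +_) (sym (NP.m≥n⇒m⊓n≡n (NP.<⇒≤ (NP.≰⇒> a≰b))))))
      lower-bound : ∀ ds → Explores F (node a) ds → optArc a b ≤ length ds
      lower-bound ds (ns , eq , covers) with run-confined L a ds faulty-left faulty-right a≤L eq
      ... | within , refl = optArc-≤ a b ds (reach 0 z≤n) (reach L NP.≤-refl)
        where reach : ∀ j → j ≤ L → j ∈ visits a ds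
              reach j j≤L = ∈-map-node⁻ j j≤L (Within⇒visits-≤L a ds a≤L within)
                              (covers (node j) (InC-node a j a≤L j≤L))

FaultFree : ∀ {n} → Subset n → Set
FaultFree F = ∀ e → lookup F e ≡ false

module FaultFreeRing {k : ℕ} (F : Subset (suc k)) (u : Fin (suc k)) (fault-free : FaultFree F) where
  open ArcWalks F u

  every-node-visited : ∀ s W → (∀ j → j ≤ k → j ∈ visits s W) → ∀ w → w ∈ map node (visits s W)
  every-node-visited s W covers w with shift-surjective u w
  ... | j , j<n , refl = MP.∈-map⁺ node (covers j (s≤s⁻¹ j<n))

  sweep : List Port
  sweep = replicate k r

  run-sweep : run F u sweep ≡ just (map node (visits 0 sweep))
  run-sweep = run-Within k 0 sweep (λ j _ → fault-free (node j)) z≤n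
    (Within-replicate-r k 0 (NP.≤-reflexive (NP.+-identityʳ k)))

  sweep-visits-all : ∀ w → w ∈ map node (visits 0 sweep)
  sweep-visits-all = every-node-visited 0 sweep
    (λ j j≤k → ∈-visits-replicate-r k 0 j (z≤n , subst (j ≤_) (sym (NP.+-identityʳ k)) j≤k))

  InC-all : ∀ w → InC F u w
  InC-all w = sweep , _ , run-sweep , sweep-visits-all w

  isOpt : IsOpt F u k
  isOpt = (sweep , LP.length-replicate k , _ , run-sweep , λ w _ → sweep-visits-all w) , lower-bound
    where
      lower-bound : ∀ ds → Explores F u ds → k ≤ length ds
      lower-bound ds (ns , eq , covers) = s≤s⁻¹ (subst (suc k ≤_) (length-run F u ds eq)
        (n≤length-of-complete ns (λ w → covers w (InC-all w))))

-- Simulation of Algorithm Ring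

<⇒<ᵇ≡true : ∀ {m n} → m < n → (m <ᵇ n) ≡ true
<⇒<ᵇ≡true m<n = Equivalence.to BP.T-≡ (NP.<⇒<ᵇ m<n)

≮⇒<ᵇ≡false : ∀ {m n} → ¬ m < n → (m <ᵇ n) ≡ false
≮⇒<ᵇ≡false {m} {n} m≮n = BP.¬-not (λ eq → m≮n (NP.<ᵇ⇒< m n (Equivalence.from BP.T-≡ eq)))

≤⇒≤ᵇ≡true : ∀ {m n} → m ≤ n → (m ≤ᵇ n) ≡ true
≤⇒≤ᵇ≡true m≤n = Equivalence.to BP.T-≡ (NP.≤⇒≤ᵇ m≤n)

≰⇒≤ᵇ≡false : ∀ {m n} → ¬ m ≤ n → (m ≤ᵇ n) ≡ false
≰⇒≤ᵇ≡false {m} {n} m≰n = BP.¬-not (λ eq → m≰n (NP.≤ᵇ⇒≤ m n (Equivalence.from BP.T-≡ eq)))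

∈⇒∈ᵇ≡true : ∀ {n} (w : Fin n) vis → w ∈ vis → (w ∈ᵇ vis) ≡ true
∈⇒∈ᵇ≡true w (x ∷ vis) w∈ with w ≟F x
... | yes _ = refl
∈⇒∈ᵇ≡true w (x ∷ vis) (here w≡x) | no w≢x = ⊥-elim (w≢x w≡x)
∈⇒∈ᵇ≡true w (x ∷ vis) (there w∈) | no _   = ∈⇒∈ᵇ≡true w vis w∈

∉⇒∈ᵇ≡false : ∀ {n} (w : Fin n) vis → ¬ w ∈ vis → (w ∈ᵇ vis) ≡ false
∉⇒∈ᵇ≡false w []        _  = refl
∉⇒∈ᵇ≡false w (x ∷ vis) w∉ with w ≟F x
... | yes w≡x = ⊥-elim (w∉ (here w≡x))
... | no  _   = ∉⇒∈ᵇ≡false w vis (λ w∈ → w∉ (there w∈))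

if-true : ∀ {A : Set} {b} {x y : A} → b ≡ true → (if b then x else y) ≡ x
if-true refl = refl

if-false : ∀ {A : Set} {b} {x y : A} → b ≡ false → (if b then x else y) ≡ y
if-false refl = refl

goFirm-step : ∀ {n} (F : Subset n) f d s → free F d (pos s) ≡ true → (length (visited s) <ᵇ n) ≡ true →
              goFirm F (suc f) d s ≡ goFirm F f d (move s d)
goFirm-step F f d s fr unfinished rewrite fr | unfinished = refl

goFirm-blocked : ∀ {n} (F : Subset n) f d s → free F d (pos s) ≡ false → goFirm F (suc f) d s ≡ s
goFirm-blocked F f d s blocked rewrite blocked = refl

goFirm-finished : ∀ {n} (F : Subset n) f d s → (length (visited s) <ᵇ n) ≡ false → goFirm F (suc f) d s ≡ s
goFirm-finished F f d s finished rewrite finished | BP.∧-zeroʳ (free F d (pos s)) = refl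

goAtDistance-step : ∀ {n} (F : Subset n) f d s → free F d (pos s) ≡ true →
                    goAtDistance F (suc f) d s ≡ goAtDistance F f d (move s d)
goAtDistance-step F f d s fr rewrite fr = refl

goAtDistance-blocked : ∀ {n} (F : Subset n) f d s → free F d (pos s) ≡ false → goAtDistance F (suc f) d s ≡ s
goAtDistance-blocked F f d s blocked rewrite blocked = refl

visit : ∀ {n} → Fin n → List (Fin n) → List (Fin n)
visit q vis = if q ∈ᵇ vis then vis else q ∷ vis

module Simulation {k : ℕ} (F : Subset (suc k)) (u : Fin (suc k)) (Lmax : ℕ) (Lmax<n : Lmax < suc k)
                  (free-inner : ArcWalks.FreeUpTo F u Lmax) (s₀ : ℕ) (s₀≤Lmax : s₀ ≤ Lmax) where
  open ArcWalks F u

  node-injective : ∀ i j → i ≤ Lmax → j ≤ Lmax → node i ≡ node j → i ≡ j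
  node-injective i j i≤ j≤ = shift-injective i j u (NP.≤-<-trans i≤ Lmax<n) (NP.≤-<-trans j≤ Lmax<n)

  record VisitedSegment (vis : List (Fin (suc k))) (lo hi : ℕ) : Set where
    field
      sound    : ∀ w → w ∈ vis → Σ ℕ λ j → InRange lo hi j × (w ≡ node j)
      complete : ∀ j → InRange lo hi j → node j ∈ vis
      size     : length vis ≡ suc hi ∸ lo
  open VisitedSegment

  revisit : ∀ {vis lo hi j} → VisitedSegment vis lo hi → InRange lo hi j → VisitedSegment (visit (node j) vis) lo hi
  revisit {vis} {j = j} seg j∈ rewrite ∈⇒∈ᵇ≡true (node j) vis (complete seg j j∈) = seg

  extend-right : ∀ {vis lo p} → VisitedSegment vis lo p → lo ≤ p → p < Lmax →
                 VisitedSegment (visit (node (suc p)) vis) lo (suc p)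
  extend-right {vis} {lo} {p} seg lo≤p p<Lmax =
    subst (λ vis′ → VisitedSegment vis′ lo (suc p)) (sym (if-false (∉⇒∈ᵇ≡false (node (suc p)) vis new))) record
    { sound    = sound′
    ; complete = complete′
    ; size     = trans (cong suc (size seg)) (sym (NP.+-∸-assoc 1 (NP.≤-trans lo≤p (NP.n≤1+n p))))
    }
    where
      new : ¬ node (suc p) ∈ vis
      new n∈ with sound seg _ n∈
      ... | j , (_ , j≤p) , eq = NP.1+n≰n (subst (_≤ p)
              (sym (node-injective (suc p) j p<Lmax (NP.≤-trans j≤p (NP.<⇒≤ p<Lmax)) eq)) j≤p)
      sound′ : ∀ w → w ∈ node (suc p) ∷ vis → Σ ℕ λ j → InRange lo (suc p) j × (w ≡ node j)
      sound′ w (here eq) = suc p , (NP.≤-trans lo≤p (NP.n≤1+n p) , NP.≤-refl) , eq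
      sound′ w (there w∈) with sound seg w w∈
      ... | j , (lo≤j , j≤p) , eq = j , (lo≤j , NP.≤-trans j≤p (NP.n≤1+n p)) , eq
      complete′ : ∀ j → InRange lo (suc p) j → node j ∈ node (suc p) ∷ vis
      complete′ j (lo≤j , j≤1+p) with j NP.≟ suc p
      ... | yes refl = here refl
      ... | no  j≢1+p = there (complete seg j (lo≤j , s≤s⁻¹ (NP.≤∧≢⇒< j≤1+p j≢1+p)))

  extend-left : ∀ {vis q hi} → VisitedSegment vis (suc q) hi → q < hi → hi ≤ Lmax →
                VisitedSegment (visit (node q) vis) q hi
  extend-left {vis} {q} {hi} seg q<hi hi≤Lmax =
    subst (λ vis′ → VisitedSegment vis′ q hi) (sym (if-false (∉⇒∈ᵇ≡false (node q) vis new))) record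
    { sound    = sound′
    ; complete = complete′
    ; size     = trans (cong suc (size seg)) (sym (NP.+-∸-assoc 1 (NP.<⇒≤ q<hi)))
    }
    where
      new : ¬ node q ∈ vis
      new n∈ with sound seg _ n∈
      ... | j , (q<j , j≤hi) , eq = NP.1+n≰n (subst (suc q ≤_)
              (sym (node-injective q j (NP.≤-trans (NP.<⇒≤ q<hi) hi≤Lmax) (NP.≤-trans j≤hi hi≤Lmax) eq)) q<j)
      sound′ : ∀ w → w ∈ node q ∷ vis → Σ ℕ λ j → InRange q hi j × (w ≡ node j)
      sound′ w (here eq) = q , (NP.≤-refl , NP.<⇒≤ q<hi) , eq
      sound′ w (there w∈) with sound seg w w∈
      ... | j , (q<j , j≤hi) , eq = j , (NP.<⇒≤ q<j , j≤hi) , eq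
      complete′ : ∀ j → InRange q hi j → node j ∈ node q ∷ vis
      complete′ j (q≤j , j≤hi) with q NP.≟ j
      ... | yes refl = here refl
      ... | no  q≢j = there (complete seg j (NP.≤∧≢⇒< q≤j q≢j , j≤hi))

  record Tracks (s : State (suc k)) (ds : List Port) (p lo hi : ℕ) : Set where
    field
      at      : pos s ≡ node p
      segment : VisitedSegment (visited s) lo hi
      traced  : trace s ≡ reverse (map node (trail s₀ ds))
      ends-at : endpoint s₀ ds ≡ p
      lo≤p    : lo ≤ p
      p≤hi    : p ≤ hi
      hi≤Lmax : hi ≤ Lmax
  open Tracks

  initially : Tracks (st (node s₀) (node s₀ ∷ []) []) [] s₀ s₀ s₀
  initially = record
    { at = refl ; traced = refl ; ends-at = refl ; lo≤p = NP.≤-refl ; p≤hi = NP.≤-refl ; hi≤Lmax = s₀≤Lmax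
    ; segment = record
      { sound    = λ { w (here eq) → s₀ , (NP.≤-refl , NP.≤-refl) , eq }
      ; complete = λ j (s₀≤j , j≤s₀) → here (cong node (NP.≤-antisym j≤s₀ s₀≤j))
      ; size     = sym (NP.m+n∸n≡m 1 s₀)
      }
    }

  trace-of : ∀ {s ds p lo hi} → Tracks s ds p lo hi → reverse (trace s) ≡ map node (trail s₀ ds)
  trace-of {ds = ds} t = trans (cong reverse (traced t)) (LP.reverse-involutive (map node (trail s₀ ds)))

  Tracks-cong : ∀ {s ds ds′ p p′ lo lo′ hi hi′} → ds ≡ ds′ → p ≡ p′ → lo ≡ lo′ → hi ≡ hi′ →
                Tracks s ds p lo hi → Tracks s ds′ p′ lo′ hi′
  Tracks-cong refl refl refl refl t = t

  move-≡ : ∀ (s : State (suc k)) d q → step d (pos s) ≡ q → move s d ≡ st q (visit q (visited s)) (q ∷ trace s)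
  move-≡ (st _ _ _) d q refl = refl

  move-Tracks : ∀ {s ds p lo hi lo′ hi′} d p′ → stepℕ d p ≡ p′ → step d (node p) ≡ node p′ →
                Tracks s ds p lo hi → VisitedSegment (visit (node p′) (visited s)) lo′ hi′ →
                lo′ ≤ p′ → p′ ≤ hi′ → hi′ ≤ Lmax → Tracks (move s d) (ds ++ d ∷ []) p′ lo′ hi′
  move-Tracks {s} {ds} {p} {lo′ = lo′} {hi′} d p′ p↦p′ node-p↦p′ t seg lo≤ ≤hi hi≤ =
    subst (λ s′ → Tracks s′ (ds ++ d ∷ []) p′ lo′ hi′) (sym (move-≡ s d (node p′) (trans (cong (step d) (at t)) node-p↦p′)))
    record { at = refl ; segment = seg ; traced = traced′ ; ends-at = ends-at′ ; lo≤p = lo≤ ; p≤hi = ≤hi ; hi≤Lmax = hi≤ }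
    where
      ends-at′ : endpoint s₀ (ds ++ d ∷ []) ≡ p′
      ends-at′ = trans (endpoint-++ s₀ ds (d ∷ [])) (trans (cong (stepℕ d) (ends-at t)) p↦p′)
      traced′ : node p′ ∷ trace s ≡ reverse (map node (trail s₀ (ds ++ d ∷ [])))
      traced′ = sym (begin
        reverse (map node (trail s₀ (ds ++ d ∷ [])))
          ≡⟨ cong (λ xs → reverse (map node xs)) (trail-∷ʳ s₀ ds d) ⟩
        reverse (map node (trail s₀ ds ++ endpoint s₀ (ds ++ d ∷ []) ∷ []))
          ≡⟨ cong (λ e → reverse (map node (trail s₀ ds ++ e ∷ []))) ends-at′ ⟩
        reverse (map node (trail s₀ ds ++ p′ ∷ []))
          ≡⟨ cong reverse (LP.map-++ node (trail s₀ ds) (p′ ∷ [])) ⟩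
        reverse (map node (trail s₀ ds) ++ node p′ ∷ [])
          ≡⟨ LP.reverse-++ (map node (trail s₀ ds)) (node p′ ∷ []) ⟩
        node p′ ∷ reverse (map node (trail s₀ ds))
          ≡⟨ cong (node p′ ∷_) (sym (traced t)) ⟩
        node p′ ∷ trace s ∎)
        where open ≡-Reasoning

  move-r-inside : ∀ {s ds p lo hi} → Tracks s ds p lo hi → p < hi → Tracks (move s r) (ds ++ r ∷ []) (suc p) lo hi
  move-r-inside t p<hi = move-Tracks r _ refl refl t (revisit (segment t) 1+p∈) (proj₁ 1+p∈) p<hi (hi≤Lmax t)
    where 1+p∈ = NP.≤-trans (lo≤p t) (NP.n≤1+n _) , p<hi

  move-r-new : ∀ {s ds p lo} → Tracks s ds p lo p → p < Lmax → Tracks (move s r) (ds ++ r ∷ []) (suc p) lo (suc p)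
  move-r-new t p<Lmax = move-Tracks r _ refl refl t (extend-right (segment t) (lo≤p t) p<Lmax)
    (NP.≤-trans (lo≤p t) (NP.n≤1+n _)) NP.≤-refl p<Lmax

  move-ℓ-inside : ∀ {s ds q lo hi} → Tracks s ds (suc q) lo hi → lo ≤ q → Tracks (move s ℓ) (ds ++ ℓ ∷ []) q lo hi
  move-ℓ-inside {q = q} t lo≤q = move-Tracks ℓ q refl (step-ℓ-node q) t (revisit (segment t) q∈) lo≤q (proj₂ q∈) (hi≤Lmax t)
    where q∈ = lo≤q , NP.≤-trans (NP.n≤1+n q) (p≤hi t)

  move-ℓ-new : ∀ {s ds q hi} → Tracks s ds (suc q) (suc q) hi → Tracks (move s ℓ) (ds ++ ℓ ∷ []) q q hi
  move-ℓ-new {q = q} t = move-Tracks ℓ q refl (step-ℓ-node q) t (extend-left (segment t) (p≤hi t) (hi≤Lmax t))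
    NP.≤-refl (NP.≤-trans (NP.n≤1+n q) (p≤hi t)) (hi≤Lmax t)

  free-r : ∀ {s ds p lo hi} → Tracks s ds p lo hi → p < Lmax → free F r (pos s) ≡ true
  free-r tr p<Lmax = trans (cong (free F r) (at tr)) (cong not (free-inner _ p<Lmax))

  blocked-r : ∀ {s ds p lo hi} → Tracks s ds p lo hi → lookup F (node p) ≡ true → free F r (pos s) ≡ false
  blocked-r tr faulty = trans (cong (free F r) (at tr)) (cong not faulty)

  free-ℓ : ∀ {s ds q lo hi} → Tracks s ds (suc q) lo hi → free F ℓ (pos s) ≡ true
  free-ℓ {q = q} tr = trans (cong (free F ℓ) (at tr))
    (trans (free-ℓ-node q) (cong not (free-inner q (NP.≤-trans (p≤hi tr) (hi≤Lmax tr)))))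

  blocked-ℓ : ∀ {s ds q lo hi} → Tracks s ds q lo hi → lookup F (prv (node q)) ≡ true → free F ℓ (pos s) ≡ false
  blocked-ℓ tr faulty = trans (cong (free F ℓ) (at tr)) (cong not faulty)

  unfinished : ∀ {s ds p lo hi} → Tracks s ds p lo hi → suc hi ∸ lo < suc k → (length (visited s) <ᵇ suc k) ≡ true
  unfinished tr lt = <⇒<ᵇ≡true (subst (_< suc k) (sym (size (segment tr))) lt)

  finished : ∀ {s ds p lo hi} → Tracks s ds p lo hi → suc hi ∸ lo ≡ suc k → (length (visited s) <ᵇ suc k) ≡ false
  finished tr all = ≮⇒<ᵇ≡false (λ lt → NP.<-irrefl (trans (size (segment tr)) all) lt)

  1+p≤T : ∀ {t p T} → suc t + p ≡ T → suc p ≤ T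
  1+p≤T {t} {p} t+p≡T = subst (suc p ≤_) t+p≡T (s≤s (NP.m≤n+m p t))

  -- GO-FIRM(r) towards a target T, beyond the visited segment, where it stops:
  -- the fuel runs out, the edge at T is faulty, or every node has been visited.
  goFirm-r : ∀ t f {s ds p lo hi T} → t + p ≡ T → Tracks s ds p lo hi → hi ≤ T → T ≤ Lmax → t ≤ f →
             (0 < t → suc hi ∸ lo < suc k) →
             (t < f → lookup F (node T) ≡ true ⊎ suc T ∸ lo ≡ suc k) →
             Tracks (goFirm F f r s) (ds ++ replicate t r) T lo T
  goFirm-r zero zero {s} {ds} refl tr hi≤T _ _ _ _ =
    Tracks-cong (sym (LP.++-identityʳ ds)) refl refl (NP.≤-antisym hi≤T (p≤hi tr)) tr
  goFirm-r zero (suc f) {s} {ds} {lo = lo} refl tr hi≤T _ _ _ stop with stop (s≤s z≤n)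
  ... | inj₁ faulty rewrite goFirm-blocked F f r s (blocked-r tr faulty) =
    Tracks-cong (sym (LP.++-identityʳ ds)) refl refl (NP.≤-antisym hi≤T (p≤hi tr)) tr
  ... | inj₂ all rewrite goFirm-finished F f r s
          (finished tr (subst (λ h → suc h ∸ lo ≡ suc k) (NP.≤-antisym (p≤hi tr) hi≤T) all)) =
    Tracks-cong (sym (LP.++-identityʳ ds)) refl refl (NP.≤-antisym hi≤T (p≤hi tr)) tr
  goFirm-r (suc t) (suc f) {s} {ds} {p} {lo} {hi} {T} t+p≡T tr hi≤T T≤Lmax (s≤s t≤f) unvisited stop
    rewrite goFirm-step F f r s (free-r tr (NP.<-≤-trans (1+p≤T t+p≡T) T≤Lmax)) (unfinished tr (unvisited (s≤s z≤n)))
    with p NP.<? hi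
  ... | yes p<hi = Tracks-cong (LP.++-assoc ds (r ∷ []) (replicate t r)) refl refl refl
        (goFirm-r t f (trans (NP.+-suc t p) t+p≡T) (move-r-inside tr p<hi) hi≤T T≤Lmax t≤f
          (λ _ → unvisited (s≤s z≤n)) (λ t<f → stop (s≤s t<f)))
  ... | no  p≮hi = Tracks-cong (LP.++-assoc ds (r ∷ []) (replicate t r)) refl refl refl
        (goFirm-r t f (trans (NP.+-suc t p) t+p≡T) (move-r-new tr′ (NP.<-≤-trans (1+p≤T t+p≡T) T≤Lmax))
          (1+p≤T t+p≡T) T≤Lmax t≤f unvisited′ (λ t<f → stop (s≤s t<f)))
    where
      tr′ : Tracks s ds p lo p
      tr′ = Tracks-cong refl refl refl (NP.≤-antisym (NP.≮⇒≥ p≮hi) (p≤hi tr)) tr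
      unvisited′ : 0 < t → suc (suc p) ∸ lo < suc k
      unvisited′ 0<t = NP.≤-<-trans (NP.m∸n≤m (suc (suc p)) lo)
        (NP.≤-<-trans (NP.≤-trans (s≤s (NP.+-monoˡ-≤ p 0<t)) (NP.≤-reflexive t+p≡T)) (NP.≤-<-trans T≤Lmax Lmax<n))

  goFirm-ℓ : ∀ t f {s ds p lo hi Q} → t + Q ≡ p → Tracks s ds p lo hi → Q ≤ lo → t ≤ f →
             (0 < t → suc hi ∸ lo < suc k) →
             (t < f → lookup F (prv (node Q)) ≡ true ⊎ suc hi ∸ Q ≡ suc k) →
             Tracks (goFirm F f ℓ s) (ds ++ replicate t ℓ) Q Q hi
  goFirm-ℓ zero zero {s} {ds} refl tr Q≤lo _ _ _ =
    Tracks-cong (sym (LP.++-identityʳ ds)) refl (NP.≤-antisym (lo≤p tr) Q≤lo) refl tr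
  goFirm-ℓ zero (suc f) {s} {ds} {hi = hi} refl tr Q≤lo _ _ stop with stop (s≤s z≤n)
  ... | inj₁ faulty rewrite goFirm-blocked F f ℓ s (blocked-ℓ tr faulty) =
    Tracks-cong (sym (LP.++-identityʳ ds)) refl (NP.≤-antisym (lo≤p tr) Q≤lo) refl tr
  ... | inj₂ all rewrite goFirm-finished F f ℓ s
          (finished tr (subst (λ l → suc hi ∸ l ≡ suc k) (NP.≤-antisym Q≤lo (lo≤p tr)) all)) =
    Tracks-cong (sym (LP.++-identityʳ ds)) refl (NP.≤-antisym (lo≤p tr) Q≤lo) refl tr
  goFirm-ℓ (suc t) (suc f) {s} {ds} {lo = lo} {hi} {Q} refl tr Q≤lo (s≤s t≤f) unvisited stop
    rewrite goFirm-step F f ℓ s (free-ℓ tr) (unfinished tr (unvisited (s≤s z≤n))) with lo NP.≤? t + Q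
  ... | yes lo≤ = Tracks-cong (LP.++-assoc ds (ℓ ∷ []) (replicate t ℓ)) refl refl refl
        (goFirm-ℓ t f refl (move-ℓ-inside tr lo≤) Q≤lo t≤f (λ _ → unvisited (s≤s z≤n)) (λ t<f → stop (s≤s t<f)))
  ... | no  lo≰ = Tracks-cong (LP.++-assoc ds (ℓ ∷ []) (replicate t ℓ)) refl refl refl
        (goFirm-ℓ t f refl (move-ℓ-new tr′) (NP.m≤n+m Q t) t≤f unvisited′ (λ t<f → stop (s≤s t<f)))
    where
      tr′ : Tracks s ds (suc (t + Q)) (suc (t + Q)) hi
      tr′ = Tracks-cong refl refl (NP.≤-antisym (lo≤p tr) (NP.≰⇒> lo≰)) refl tr
      unvisited′ : 0 < t → suc hi ∸ (t + Q) < suc k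
      unvisited′ 0<t = NP.≤-<-trans (NP.∸-monoʳ-≤ (suc hi) (NP.≤-trans 0<t (NP.m≤m+n t Q)))
                         (NP.≤-<-trans (hi≤Lmax tr) Lmax<n)

  goAtDistance-ℓ : ∀ t f {s ds p hi Q} → t + Q ≡ p → Tracks s ds p p hi → t ≤ f →
                   (t < f → lookup F (prv (node Q)) ≡ true) →
                   Tracks (goAtDistance F f ℓ s) (ds ++ replicate t ℓ) Q Q hi
  goAtDistance-ℓ zero zero    {ds = ds} refl tr _ _ = Tracks-cong (sym (LP.++-identityʳ ds)) refl refl refl tr
  goAtDistance-ℓ zero (suc f) {s} {ds} refl tr _ stop rewrite goAtDistance-blocked F f ℓ s (blocked-ℓ tr (stop (s≤s z≤n))) =
    Tracks-cong (sym (LP.++-identityʳ ds)) refl refl refl tr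
  goAtDistance-ℓ (suc t) (suc f) {s} {ds} refl tr (s≤s t≤f) stop rewrite goAtDistance-step F f ℓ s (free-ℓ tr) =
    Tracks-cong (LP.++-assoc ds (ℓ ∷ []) (replicate t ℓ)) refl refl refl
      (goAtDistance-ℓ t f refl (move-ℓ-new tr) t≤f (λ t<f → stop (s≤s t<f)))

-- The cost of Algorithm Ring

∈-take-∷ʳ⁻ : ∀ {A : Set} {x : A} c xs y → c ≤ length xs → x ∈ take c (xs ++ y ∷ []) → x ∈ xs
∈-take-∷ʳ⁻ (suc c) (x′ ∷ xs) y (s≤s c≤) (here eq)  = here eq
∈-take-∷ʳ⁻ (suc c) (x′ ∷ xs) y (s≤s c≤) (there x∈) = there (∈-take-∷ʳ⁻ c xs y c≤ x∈)

-- The trace ends with the first visit of y, the last node of C to be visited.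
isRingCost-of-trace : ∀ {n} {F : Subset n} {v} xs y → ringAlgTrace F v ≡ xs ++ y ∷ [] →
                      CoversC F v (v ∷ xs ++ y ∷ []) → InC F v y → ¬ y ∈ v ∷ xs →
                      IsRingCost F v (length (xs ++ y ∷ []))
isRingCost-of-trace {F = F} {v} xs y trace≡ covers y∈C y-new rewrite trace≡ =
  NP.≤-refl , subst (λ zs → CoversC F v (v ∷ zs)) (sym (LP.take-all _ (xs ++ y ∷ []) NP.≤-refl)) covers , minimal
  where
    minimal : ∀ c′ → CoversC F v (v ∷ take c′ (xs ++ y ∷ [])) → length (xs ++ y ∷ []) ≤ c′
    minimal c′ covers′ with length (xs ++ y ∷ []) NP.≤? c′
    ... | yes enough = enough
    ... | no  short  with covers′ y y∈C
    ...   | here y≡v  = ⊥-elim (y-new (here y≡v))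
    ...   | there y∈  = ⊥-elim (y-new (there (∈-take-∷ʳ⁻ c′ xs y c′≤ y∈)))
      where c′≤ = s≤s⁻¹ (NP.≤-trans (NP.≰⇒> short) (NP.≤-reflexive (trans (LP.length-++ xs) (NP.+-comm _ 1))))

module _ {k : ℕ} (F : Subset (suc k)) (u : Fin (suc k)) where
  open ArcWalks F u

  isRingCost-of-walk : ∀ L s W W₀ d e {lo hi} → L < suc k → W ≡ W₀ ++ d ∷ [] → endpoint s W ≡ e →
    ringAlgTrace F (node s) ≡ map node (trail s W) →
    CoversC F (node s) (map node (visits s W)) → InC F (node s) (node e) →
    InRange lo hi s → Within lo hi s W₀ → hi ≤ L → e ≤ L → ¬ InRange lo hi e →
    IsRingCost F (node s) (length W)
  isRingCost-of-walk L s W W₀ d e {lo} {hi} L<n refl refl trace≡ covers e∈C s∈ within hi≤L e≤L e∉ =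
    subst (IsRingCost F (node s)) length≡
      (isRingCost-of-trace {F = F} {node s} (map node (trail s W₀)) (node e) trace≡′ covers′ e∈C new)
    where
      trail≡ : map node (trail s W) ≡ map node (trail s W₀) ++ node e ∷ []
      trail≡ = trans (cong (map node) (trail-∷ʳ s W₀ d)) (LP.map-++ node (trail s W₀) (e ∷ []))
      trace≡′ = trans trace≡ trail≡
      covers′ = subst (λ zs → CoversC F (node s) (node s ∷ zs)) trail≡ covers
      length≡ : length (map node (trail s W₀) ++ node e ∷ []) ≡ length W
      length≡ = trans (cong length (sym trail≡)) (trans (LP.length-map node (trail s W)) (length-trail s W))
      new : ¬ node e ∈ map node (visits s W₀)
      new e∈ with MP.∈-map⁻ node e∈
      ... | x , x∈ , e≡x with All.lookup (Within⇒visits-InRange s W₀ s∈ within) x∈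
      ...   | x∈range = e∉ (subst (InRange lo hi)
                (shift-injective x e u (NP.≤-<-trans (NP.≤-trans (proj₂ x∈range) hi≤L) L<n) (NP.≤-<-trans e≤L L<n) (sym e≡x))
                x∈range)

probe : ℕ → ℕ
probe n = if n ≤ᵇ 19 then 1 else 2

probe≤2 : ∀ n → probe n ≤ 2
probe≤2 n with n ≤ᵇ 19
... | true  = s≤s z≤n
... | false = NP.≤-refl

probe<n∸1 : ∀ k → (suc k ≤ᵇ 5) ≡ false → probe (suc k) < k
probe<n∸1 k large = NP.≤-<-trans (probe≤2 (suc k)) (NP.≤-trans (s≤s (s≤s (s≤s z≤n))) (s≤s⁻¹ 5<n))
  where 5<n : 5 < suc k
        5<n = NP.≰⇒> (λ n≤5 → subst T large (NP.≤⇒≤ᵇ n≤5))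

module _ {n : ℕ} (F : Subset n) (v : Fin n) where

  start : State n
  start = st v (v ∷ []) []

  probed : State n
  probed = goAtDistance F (probe n) ℓ start

  ringAlgState-ℓ-blocked : free F ℓ v ≡ false → ringAlgState F v ≡ goFirm F n r start
  ringAlgState-ℓ-blocked fℓ = if-true (cong not fℓ)

  ringAlgState-r-blocked : free F ℓ v ≡ true → free F r v ≡ false → ringAlgState F v ≡ goFirm F n ℓ start
  ringAlgState-r-blocked fℓ fr = trans (if-false (cong not fℓ)) (if-true (cong not fr))

  ringAlgState-small : free F ℓ v ≡ true → free F r v ≡ true → (n ≤ᵇ 5) ≡ true →
                       ringAlgState F v ≡ goFirm F n r (goFirm F n ℓ start)
  ringAlgState-small fℓ fr small = trans (if-false (cong not fℓ)) (trans (if-false (cong not fr)) (if-true small))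

  ringAlgState-probe-blocked : free F ℓ v ≡ true → free F r v ≡ true → (n ≤ᵇ 5) ≡ false →
                               free F ℓ (pos probed) ≡ false → ringAlgState F v ≡ goFirm F n r probed
  ringAlgState-probe-blocked fℓ fr large b =
    trans (if-false (cong not fℓ)) (trans (if-false (cong not fr)) (trans (if-false large) (if-false b)))

  ringAlgState-probe-free : free F ℓ v ≡ true → free F r v ≡ true → (n ≤ᵇ 5) ≡ false →
                            free F ℓ (pos probed) ≡ true → ringAlgState F v ≡ goFirm F n ℓ (goFirm F n r probed)
  ringAlgState-probe-free fℓ fr large b =
    trans (if-false (cong not fℓ)) (trans (if-false (cong not fr)) (trans (if-false large) (if-true b)))

module ArcCost {k : ℕ} {F : Subset (suc k)} {u : Fin (suc k)} (a b : ℕ) (arc : IsComponentArc F u (a + b)) where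
  open Arc a b arc public
  open Simulation F u L L<n free-inner a a≤L public

  isRingCost-sweep : ∀ W W₀ d e {lo hi} → W ≡ W₀ ++ d ∷ [] → endpoint a W ≡ e →
    ringAlgTrace F (node a) ≡ map node (trail a W) → (∀ j → j ≤ L → j ∈ visits a W) →
    InRange lo hi a → Within lo hi a W₀ → hi ≤ L → e ≤ L → ¬ InRange lo hi e →
    IsRingCost F (node a) (length W)
  isRingCost-sweep W W₀ d e W≡ e≡ trace≡ covers a∈ within hi≤L e≤L e∉ =
    isRingCost-of-walk F u L a W W₀ d e L<n W≡ e≡ trace≡ (covers-arc a W a≤L covers)
      (InC-node a e a≤L e≤L) a∈ within hi≤L e≤L e∉

  trace-from : ∀ {s W p lo hi} → ringAlgState F (node a) ≡ s → Tracks s W p lo hi →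
               ringAlgTrace F (node a) ≡ map node (trail a W)
  trace-from eq tr = trans (cong (λ s → reverse (trace s)) eq) (trace-of tr)

-- The cost of Algorithm Ring from position a of an arc with b nodes to its right
ringCost : ℕ → ℕ → ℕ → ℕ
ringCost n zero    b       = b
ringCost n (suc a) zero    = suc a
ringCost n (suc a) (suc b) =
  if n ≤ᵇ 5 then suc a + (suc a + suc b)
  else if suc a ≤ᵇ probe n then suc a + (suc a + suc b)
  else (probe n + (probe n + suc b)) + (suc a + suc b)

module ArcRun {k : ℕ} (1<n : 1 < suc k) {F : Subset (suc k)} {u : Fin (suc k)} where

  cost-from-left-end : ∀ b (arc : IsComponentArc F u b) → IsRingCost F u b
  cost-from-left-end zero arc = z≤n , covers-arc 0 [] z≤n (λ { zero _ → here refl }) , λ _ _ → z≤n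
    where open Arc 0 0 arc
  cost-from-left-end (suc b) arc = subst (IsRingCost F u) (LP.length-replicate (suc b))
    (isRingCost-sweep (replicate (suc b) r) (replicate b r) r (suc b) (replicate-∷ʳ b r)
      (trans (endpoint-replicate-r (suc b) 0) (NP.+-identityʳ (suc b))) trace≡ covers
      (z≤n , z≤n) (Within-replicate-r b 0 (NP.≤-reflexive (NP.+-identityʳ b))) (NP.n≤1+n b) NP.≤-refl
      (λ (_ , 1+b≤b) → NP.1+n≰n 1+b≤b))
    where
      open ArcCost 0 (suc b) arc
      tr : Tracks (goFirm F (suc k) r (start F u)) (replicate (suc b) r) (suc b) 0 (suc b)
      tr = goFirm-r (suc b) (suc k) (NP.+-identityʳ (suc b)) initially z≤n NP.≤-refl (NP.<⇒≤ L<n)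
             (λ _ → 1<n) (λ _ → inj₁ faulty-right)
      trace≡ = trace-from (ringAlgState-ℓ-blocked F u (cong not faulty-left)) tr
      covers : ∀ j → j ≤ suc b → j ∈ visits 0 (replicate (suc b) r)
      covers j j≤ = ∈-visits-replicate-r (suc b) 0 j (z≤n , subst (j ≤_) (sym (NP.+-identityʳ (suc b))) j≤)

  cost-from-right-end : ∀ a (arc : IsComponentArc F u (suc a + 0)) → IsRingCost F (shift (suc a) u) (suc a)
  cost-from-right-end a arc = subst (IsRingCost F (node (suc a))) (LP.length-replicate (suc a))
    (isRingCost-sweep (replicate (suc a) ℓ) (replicate a ℓ) ℓ 0 (replicate-∷ʳ a ℓ) endpoint≡ trace≡ covers
      (s≤s z≤n , NP.≤-refl) within (NP.≤-reflexive (sym a+0)) z≤n (λ ()))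
    where
      open ArcCost (suc a) 0 arc
      a+0 : suc a + 0 ≡ suc a
      a+0 = NP.+-identityʳ (suc a)
      fℓ : free F ℓ (node (suc a)) ≡ true
      fℓ = trans (free-ℓ-node a) (cong not (free-inner a (NP.≤-reflexive (sym a+0))))
      fr : free F r (node (suc a)) ≡ false
      fr = cong not (subst (λ z → lookup F (node z) ≡ true) a+0 faulty-right)
      tr : Tracks (goFirm F (suc k) ℓ (start F (node (suc a)))) (replicate (suc a) ℓ) 0 0 (suc a)
      tr = goFirm-ℓ (suc a) (suc k) a+0 initially z≤n (NP.<⇒≤ (subst (_< suc k) a+0 L<n))
             (λ _ → subst (_< suc k) (sym (NP.m+n∸n≡m 1 (suc a))) 1<n) (λ _ → inj₁ faulty-left)
      trace≡ = trace-from (ringAlgState-r-blocked F (node (suc a)) fℓ fr) tr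
      endpoint≡ : endpoint (suc a) (replicate (suc a) ℓ) ≡ 0
      endpoint≡ = subst (λ s → endpoint s (replicate (suc a) ℓ) ≡ 0) a+0 (endpoint-replicate-ℓ (suc a) 0)
      within : Within 1 (suc a) (suc a) (replicate a ℓ)
      within = Within-suc a (replicate a ℓ)
        (subst (λ s → Within 0 a s (replicate a ℓ)) (NP.+-identityʳ a) (Within-replicate-ℓ a 0 z≤n))
      covers : ∀ j → j ≤ suc a + 0 → j ∈ visits (suc a) (replicate (suc a) ℓ)
      covers j j≤ = subst (λ s → j ∈ visits s (replicate (suc a) ℓ)) a+0 (∈-visits-replicate-ℓ (suc a) 0 j (z≤n , j≤))

  module _ (a b : ℕ) (arc : IsComponentArc F u (suc a + suc b)) where
    open ArcCost (suc a) (suc b) arc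

    L′ : ℕ
    L′ = a + suc b

    1+a≤L′ : suc a ≤ L′
    1+a≤L′ = subst (suc a ≤_) (sym (NP.+-suc a b)) (s≤s (NP.m≤m+n a b))

    fℓ : free F ℓ (node (suc a)) ≡ true
    fℓ = trans (free-ℓ-node a) (cong not (free-inner a (s≤s (NP.m≤m+n a (suc b)))))

    fr : free F r (node (suc a)) ≡ true
    fr = cong not (free-inner (suc a) (s≤s 1+a≤L′))

    -- Once the left end is reached, GO-FIRM(r) finishes the exploration.
    cost-left-first : ∀ {S₁} → Tracks S₁ (replicate (suc a) ℓ) 0 0 (suc a) →
                      ringAlgState F (node (suc a)) ≡ goFirm F (suc k) r S₁ →
                      IsRingCost F (node (suc a)) (suc a + (suc a + suc b))
    cost-left-first tr₁ alg = subst (IsRingCost F (node (suc a))) (length-sweepℓr (suc a) L)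
      (isRingCost-sweep (sweepℓr (suc a) L) (sweepℓr (suc a) L′) r L (sweepℓr-∷ʳ (suc a) L′)
        (endpoint-sweepℓr (suc a) L) (trace-from alg tr₂) (∈-visits-sweepℓr (suc a) L)
        (z≤n , 1+a≤L′) (Within-sweepℓr (suc a) L′ 1+a≤L′ NP.≤-refl) (NP.n≤1+n L′) NP.≤-refl (λ (_ , L≤L′) → NP.1+n≰n L≤L′))
      where
        tr₂ : Tracks (goFirm F (suc k) r _) (sweepℓr (suc a) L) L 0 L
        tr₂ = goFirm-r L (suc k) (NP.+-identityʳ L) tr₁ a≤L NP.≤-refl (NP.<⇒≤ L<n)
                (λ _ → NP.≤-<-trans (s≤s 1+a≤L′) L<n) (λ _ → inj₁ faulty-right)

    cost-small : (suc k ≤ᵇ 5) ≡ true → IsRingCost F (node (suc a)) (suc a + (suc a + suc b))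
    cost-small small = cost-left-first tr₁ (ringAlgState-small F (node (suc a)) fℓ fr small)
      where
        tr₁ : Tracks (goFirm F (suc k) ℓ (start F (node (suc a)))) (replicate (suc a) ℓ) 0 0 (suc a)
        tr₁ = goFirm-ℓ (suc a) (suc k) (NP.+-identityʳ (suc a)) initially z≤n (NP.<⇒≤ (NP.≤-<-trans a≤L L<n))
                (λ _ → subst (_< suc k) (sym (NP.m+n∸n≡m 1 (suc a))) 1<n) (λ _ → inj₁ faulty-left)

    cost-probe-blocked : (suc k ≤ᵇ 5) ≡ false → suc a ≤ probe (suc k) → IsRingCost F (node (suc a)) (suc a + (suc a + suc b))
    cost-probe-blocked large 1+a≤κ =
      cost-left-first tr₁ (ringAlgState-probe-blocked F (node (suc a)) fℓ fr large (blocked-ℓ tr₁ faulty-left))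
      where
        tr₁ : Tracks (probed F (node (suc a))) (replicate (suc a) ℓ) 0 0 (suc a)
        tr₁ = goAtDistance-ℓ (suc a) (probe (suc k)) (NP.+-identityʳ (suc a)) initially 1+a≤κ (λ _ → faulty-left)

    -- The probe stops at x = a + 1 - κ with port ℓ still free; the agent turns
    -- right to the right end, then back to the left end.
    cost-probe-free : (suc k ≤ᵇ 5) ≡ false → probe (suc k) ≤ a →
                      IsRingCost F (node (suc a)) ((probe (suc k) + (probe (suc k) + suc b)) + (suc a + suc b))
    cost-probe-free large κ≤a = subst (IsRingCost F (node (suc a))) length≡
      (isRingCost-sweep W (probe-sweep κ x′ y) ℓ 0 (probe-sweep-∷ʳ κ x′ y)
        (subst (λ s → endpoint s W ≡ 0) κ+x≡1+a (endpoint-probe-sweep κ x y))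
        (trace-from alg tr₃) covers (s≤s z≤n , a≤L) within NP.≤-refl z≤n (λ ()))
      where
        κ = probe (suc k)
        x′ = a ∸ κ
        x = suc x′
        y = κ + suc b
        W = probe-sweep κ x y
        κ+x≡1+a : κ + x ≡ suc a
        κ+x≡1+a = trans (NP.+-suc κ x′) (cong suc (NP.m+[n∸m]≡n κ≤a))
        x+y≡L : x + y ≡ L
        x+y≡L = begin
          x + (κ + suc b)   ≡⟨ sym (NP.+-assoc x κ (suc b)) ⟩
          (x + κ) + suc b   ≡⟨ cong (_+ suc b) (trans (NP.+-comm x κ) κ+x≡1+a) ⟩
          suc a + suc b     ∎
          where open ≡-Reasoning
        covers : ∀ j → j ≤ L → j ∈ visits (suc a) W
        covers j j≤L = subst (λ s → j ∈ visits s W) κ+x≡1+a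
          (∈-visits-probe-sweep κ x y j (subst (j ≤_) (sym x+y≡L) j≤L))
        within : Within 1 L (suc a) (probe-sweep κ x′ y)
        within = subst₂ (λ hi s → Within 1 hi s (probe-sweep κ x′ y)) x+y≡L κ+x≡1+a (Within-probe-sweep κ x′ y)
        length≡ : length W ≡ (κ + y) + L
        length≡ = trans (length-probe-sweep κ x y) (trans (cong (λ z → κ + (y + z)) x+y≡L) (sym (NP.+-assoc κ y L)))
        tr₁ : Tracks (probed F (node (suc a))) (replicate κ ℓ) x x (suc a)
        tr₁ = goAtDistance-ℓ κ κ κ+x≡1+a initially NP.≤-refl (λ κ<κ → ⊥-elim (NP.<-irrefl refl κ<κ))
        tr₂ : Tracks (goFirm F (suc k) r (probed F (node (suc a)))) (replicate κ ℓ ++ replicate y r) L x L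
        tr₂ = goFirm-r y (suc k) (trans (NP.+-comm y x) x+y≡L) tr₁ a≤L NP.≤-refl
                (NP.≤-trans (NP.m≤n+m y x) (NP.≤-trans (NP.≤-reflexive x+y≡L) (NP.<⇒≤ L<n)))
                (λ _ → NP.≤-<-trans (NP.m∸n≤m (suc (suc a)) x) (NP.≤-<-trans (s≤s 1+a≤L′) L<n))
                (λ _ → inj₁ faulty-right)
        tr₃ : Tracks (goFirm F (suc k) ℓ (goFirm F (suc k) r (probed F (node (suc a))))) W 0 0 L
        tr₃ = Tracks-cong (LP.++-assoc (replicate κ ℓ) (replicate y r) (replicate (x + y) ℓ)) refl refl refl
                (goFirm-ℓ (x + y) (suc k) (trans (NP.+-identityʳ (x + y)) x+y≡L) tr₂ z≤n
                  (subst (_≤ suc k) (sym x+y≡L) (NP.<⇒≤ L<n))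
                  (λ _ → NP.≤-<-trans (NP.m∸n≤m L x′) L<n) (λ _ → inj₁ faulty-left))
        alg = ringAlgState-probe-free F (node (suc a)) fℓ fr large (free-ℓ tr₁)

  isRingCost-arc : ∀ a b (arc : IsComponentArc F u (a + b)) → IsRingCost F (shift a u) (ringCost (suc k) a b)
  isRingCost-arc zero    b       arc = cost-from-left-end b arc
  isRingCost-arc (suc a) zero    arc = cost-from-right-end a arc
  isRingCost-arc (suc a) (suc b) arc = by-size (suc k ≤ᵇ 5) refl
    where
      by-size : ∀ x → (suc k ≤ᵇ 5) ≡ x → IsRingCost F (shift (suc a) u) (ringCost (suc k) (suc a) (suc b))
      by-size true  small = subst (IsRingCost F _) (sym (if-true small)) (cost-small a b arc small)
      by-size false large with suc a NP.≤? probe (suc k)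
      ... | yes near = subst (IsRingCost F _) (sym (trans (if-false large) (if-true (≤⇒≤ᵇ≡true near))))
                         (cost-probe-blocked a b arc large near)
      ... | no  far  = subst (IsRingCost F _) (sym (trans (if-false large) (if-false (≰⇒≤ᵇ≡false far))))
                         (cost-probe-free a b arc large (s≤s⁻¹ (NP.≰⇒> far)))

ringCostFaultFree : ℕ → ℕ
ringCostFaultFree n = if n ≤ᵇ 5 then n ∸ 1 else probe n + (n ∸ 1)

module FaultFreeRun {k′ : ℕ} (F : Subset (suc (suc k′))) (u : Fin (suc (suc k′))) (fault-free : FaultFree F) where
  open FaultFreeRing F u fault-free
  open ArcWalks F u

  free-all : FreeUpTo (suc k′)
  free-all j _ = fault-free (node j)

  isRingCost-sweep : ∀ s W W₀ d e {lo hi} → W ≡ W₀ ++ d ∷ [] → endpoint s W ≡ e →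
    ringAlgTrace F (node s) ≡ map node (trail s W) → (∀ j → j ≤ suc k′ → j ∈ visits s W) →
    InRange lo hi s → Within lo hi s W₀ → hi ≤ suc k′ → e ≤ suc k′ → ¬ InRange lo hi e →
    IsRingCost F (node s) (length W)
  isRingCost-sweep s W W₀ d e W≡ e≡ trace≡ covers =
    isRingCost-of-walk F u (suc k′) s W W₀ d e NP.≤-refl W≡ e≡ trace≡ (λ w _ → every-node-visited s W covers w)
      (FaultFreeRing.InC-all F (node s) fault-free _)

  cost-small : (suc (suc k′) ≤ᵇ 5) ≡ true → IsRingCost F (shift (suc k′) u) (suc k′)
  cost-small small = subst (IsRingCost F (node (suc k′))) (LP.length-replicate (suc k′))
    (isRingCost-sweep (suc k′) (replicate (suc k′) ℓ) (replicate k′ ℓ) ℓ 0 (replicate-∷ʳ k′ ℓ) endpoint≡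
      (trans (cong (λ s → reverse (trace s)) alg) (trace-of tr)) covers
      (s≤s z≤n , NP.≤-refl) within NP.≤-refl z≤n (λ ()))
    where
      endpoint≡ : endpoint (suc k′) (replicate (suc k′) ℓ) ≡ 0
      endpoint≡ = subst (λ s → endpoint s (replicate (suc k′) ℓ) ≡ 0) (NP.+-identityʳ (suc k′)) (endpoint-replicate-ℓ (suc k′) 0)
      within : Within 1 (suc k′) (suc k′) (replicate k′ ℓ)
      within = subst (λ s → Within 1 (suc k′) s (replicate k′ ℓ)) (NP.+-comm k′ 1) (Within-replicate-ℓ k′ 1 NP.≤-refl)
      covers : ∀ j → j ≤ suc k′ → j ∈ visits (suc k′) (replicate (suc k′) ℓ)
      covers j j≤k = subst (λ s → j ∈ visits s (replicate (suc k′) ℓ)) (NP.+-identityʳ (suc k′))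
                       (∈-visits-replicate-ℓ (suc k′) 0 j (z≤n , subst (j ≤_) (sym (NP.+-identityʳ (suc k′))) j≤k))
      open Simulation F u (suc k′) NP.≤-refl free-all (suc k′) NP.≤-refl
      tr : Tracks (goFirm F (suc (suc k′)) ℓ (start F (node (suc k′)))) (replicate (suc k′) ℓ) 0 0 (suc k′)
      tr = goFirm-ℓ (suc k′) (suc (suc k′)) (NP.+-identityʳ (suc k′)) initially z≤n (NP.n≤1+n (suc k′))
             (λ _ → subst (_< suc (suc k′)) (sym (NP.m+n∸n≡m 1 (suc k′))) (s≤s (s≤s z≤n))) (λ _ → inj₂ refl)
      alg : ringAlgState F (node (suc k′)) ≡ goFirm F (suc (suc k′)) ℓ (start F (node (suc k′)))
      alg = trans (ringAlgState-small F (node (suc k′)) (cong not (fault-free _)) (cong not (fault-free _)) small)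
                  (goFirm-finished F (suc k′) r _ (finished tr refl))

  cost-large : (suc (suc k′) ≤ᵇ 5) ≡ false → IsRingCost F (shift (probe (suc (suc k′))) u) (probe (suc (suc k′)) + suc k′)
  cost-large large = subst (IsRingCost F (node κ)) (length-sweepℓr κ (suc k′))
    (isRingCost-sweep κ (sweepℓr κ (suc k′)) (sweepℓr κ k′) r (suc k′) (sweepℓr-∷ʳ κ k′) (endpoint-sweepℓr κ (suc k′))
      (trans (cong (λ s → reverse (trace s)) alg) (trace-of tr₂)) (∈-visits-sweepℓr κ (suc k′))
      (z≤n , κ≤k′) (Within-sweepℓr κ k′ κ≤k′ NP.≤-refl) (NP.n≤1+n k′) NP.≤-refl (λ (_ , k≤k′) → NP.1+n≰n k≤k′))
    where
      κ = probe (suc (suc k′))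
      κ≤k′ : κ ≤ k′
      κ≤k′ = s≤s⁻¹ (probe<n∸1 (suc k′) large)
      open Simulation F u (suc k′) NP.≤-refl free-all κ (NP.≤-trans κ≤k′ (NP.n≤1+n k′))
      tr₁ : Tracks (probed F (node κ)) (replicate κ ℓ) 0 0 κ
      tr₁ = goAtDistance-ℓ κ κ (NP.+-identityʳ κ) initially NP.≤-refl (λ κ<κ → ⊥-elim (NP.<-irrefl refl κ<κ))
      tr₂ : Tracks (goFirm F (suc (suc k′)) r (probed F (node κ))) (sweepℓr κ (suc k′)) (suc k′) 0 (suc k′)
      tr₂ = goFirm-r (suc k′) (suc (suc k′)) (NP.+-identityʳ (suc k′)) tr₁ (NP.≤-trans κ≤k′ (NP.n≤1+n k′)) NP.≤-refl (NP.n≤1+n (suc k′))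
              (λ _ → s≤s (s≤s κ≤k′)) (λ _ → inj₂ refl)
      alg : ringAlgState F (node κ) ≡ goFirm F (suc (suc k′)) r (probed F (node κ))
      alg = trans (ringAlgState-probe-free F (node κ) (cong not (fault-free _)) (cong not (fault-free _)) large
                    (cong not (fault-free _)))
                  (goFirm-finished F (suc k′) ℓ _ (finished tr₂ refl))

-- Components of a fault configuration

least-true : (P : ℕ → Bool) → ∀ d₀ → P d₀ ≡ true →
             Σ ℕ λ d → (d ≤ d₀) × (P d ≡ true) × (∀ j → j < d → P j ≡ false)
least-true P d₀ Pd₀ with P 0 in P0
... | true = 0 , z≤n , P0 , λ _ ()
least-true P zero Pd₀ | false with trans (sym Pd₀) P0
... | ()
least-true P (suc d₀) Pd₀ | false with least-true (λ j → P (suc j)) d₀ Pd₀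
... | d , d≤d₀ , Pd , below = suc d , s≤s d≤d₀ , Pd , below′
  where below′ : ∀ j → j < suc d → P j ≡ false
        below′ zero    _         = P0
        below′ (suc j) (s≤s j<d) = below j j<d

-- the node a steps before v
back : ∀ {k} → ℕ → Fin (suc k) → Fin (suc k)
back {k} a v = shift (suc (k ∸ a)) v

shift-back : ∀ {k} a (v : Fin (suc k)) → a ≤ k → shift a (back a v) ≡ v
shift-back {k} a v a≤k = begin
  shift a (shift (suc (k ∸ a)) v)   ≡⟨ sym (shift-+ a (suc (k ∸ a)) v) ⟩
  shift (a + suc (k ∸ a)) v         ≡⟨ cong (λ z → shift z v) (trans (NP.+-suc a (k ∸ a)) (cong suc (NP.m+[n∸m]≡n a≤k))) ⟩
  shift (suc k) v                   ≡⟨ shift-cycle v ⟩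
  v                                 ∎
  where open ≡-Reasoning

shift-back-< : ∀ {k} a j (v : Fin (suc k)) → a ≤ k → j < a → shift j (back a v) ≡ shift (k ∸ (a ∸ suc j)) v
shift-back-< {k} a j v a≤k j<a = trans (sym (shift-+ j (suc (k ∸ a)) v)) (cong (λ z → shift z v) j+1+[k∸a]≡)
  where
    j+1+[k∸a]≡ : j + suc (k ∸ a) ≡ k ∸ (a ∸ suc j)
    j+1+[k∸a]≡ = begin
      j + suc (k ∸ a)                          ≡⟨ NP.+-comm j (suc (k ∸ a)) ⟩
      suc (k ∸ a) + j                          ≡⟨ sym (NP.+-suc (k ∸ a) j) ⟩
      (k ∸ a) + suc j                          ≡⟨ sym (NP.m+n∸n≡m _ (a ∸ suc j)) ⟩
      (k ∸ a) + suc j + (a ∸ suc j) ∸ (a ∸ suc j) ≡⟨ cong (_∸ (a ∸ suc j)) (begin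
          (k ∸ a) + suc j + (a ∸ suc j)        ≡⟨ NP.+-assoc (k ∸ a) (suc j) (a ∸ suc j) ⟩
          (k ∸ a) + (suc j + (a ∸ suc j))      ≡⟨ cong ((k ∸ a) +_) (NP.m+[n∸m]≡n j<a) ⟩
          (k ∸ a) + a                          ≡⟨ NP.m∸n+n≡m a≤k ⟩
          k                                    ∎) ⟩
      k ∸ (a ∸ suc j)                          ∎
      where open ≡-Reasoning

shift-back-≥ : ∀ {k} a j (v : Fin (suc k)) → a ≤ k → a ≤ j → shift j (back a v) ≡ shift (j ∸ a) v
shift-back-≥ a j v a≤k a≤j = begin
  shift j (back a v)                 ≡⟨ cong (λ z → shift z (back a v)) (sym (NP.m∸n+n≡m a≤j)) ⟩
  shift (j ∸ a + a) (back a v)       ≡⟨ shift-+ (j ∸ a) a (back a v) ⟩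
  shift (j ∸ a) (shift a (back a v)) ≡⟨ cong (shift (j ∸ a)) (shift-back a v a≤k) ⟩
  shift (j ∸ a) v                    ∎
  where open ≡-Reasoning

record ArcAround {k : ℕ} (F : Subset (suc k)) (v : Fin (suc k)) : Set where
  field
    a b   : ℕ
    isArc : IsComponentArc F (back a v) (a + b)
    a≤k   : a ≤ k

-- Search for the first faulty edge to the right (b) and to the left (a) of v.
component-of : ∀ {k} (F : Subset (suc k)) (v : Fin (suc k)) → FaultFree F ⊎ ArcAround F v
component-of {k} F v with FP.all? (λ e → lookup F e BP.≟ false)
... | yes fault-free = inj₁ fault-free
... | no  faulty with FP.¬∀⟶∃¬ (suc k) (λ e → lookup F e ≡ false) (λ e → lookup F e BP.≟ false) faulty
... | e , e-faulty with shift-surjective v e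
... | d₀ , d₀<n , refl = inj₂ record { a = a ; b = b ; isArc = isArc ; a≤k = a≤k }
  where
    faulty-right-of faulty-left-of : ℕ → Bool
    faulty-right-of d = lookup F (shift d v)
    faulty-left-of  d = lookup F (shift (k ∸ d) v)
    d₀≤k = s≤s⁻¹ d₀<n
    right = least-true faulty-right-of d₀ (BP.¬-not e-faulty)
    left  = least-true faulty-left-of (k ∸ d₀)
              (subst (λ z → lookup F (shift z v) ≡ true) (sym (NP.m∸[m∸n]≡n d₀≤k)) (BP.¬-not e-faulty))
    a = proj₁ left
    b = proj₁ right
    a≤k : a ≤ k
    a≤k = NP.≤-trans (proj₁ (proj₂ left)) (NP.m∸n≤m k d₀)
    b≤k∸a : b ≤ k ∸ a
    b≤k∸a = NP.≮⇒≥ (λ k∸a<b → true≢false (trans (sym (proj₁ (proj₂ (proj₂ left))))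
                                          (proj₂ (proj₂ (proj₂ right)) (k ∸ a) k∸a<b)))
      where true≢false : true ≢ false
            true≢false ()
    isArc : IsComponentArc F (back a v) (a + b)
    isArc = record
      { L<n          = s≤s (NP.≤-trans (NP.+-monoʳ-≤ a b≤k∸a) (NP.≤-reflexive (NP.m+[n∸m]≡n a≤k)))
      ; free-inner   = free-inner
      ; faulty-left  = trans (cong (lookup F) (prv-nxt _)) (proj₁ (proj₂ (proj₂ left)))
      ; faulty-right = trans (cong (lookup F) (trans (shift-back-≥ a (a + b) v a≤k (NP.m≤m+n a b))
                                                      (cong (λ z → shift z v) (NP.m+n∸m≡n a b))))
                             (proj₁ (proj₂ (proj₂ right)))
      }
      where
        free-inner : ∀ j → j < a + b → lookup F (shift j (back a v)) ≡ false
        free-inner j j<a+b with j NP.<? a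
        ... | yes j<a = trans (cong (lookup F) (shift-back-< a j v a≤k j<a))
                          (proj₂ (proj₂ (proj₂ left)) (a ∸ suc j) (NP.∸-monoʳ-< {a} (s≤s z≤n) j<a))
        ... | no  j≮a = trans (cong (lookup F) (shift-back-≥ a j v a≤k (NP.≮⇒≥ j≮a)))
                          (proj₂ (proj₂ (proj₂ right)) (j ∸ a)
                            (NP.+-cancelˡ-< a _ _ (subst (_< a + b) (sym (NP.m+[n∸m]≡n (NP.≮⇒≥ j≮a))) j<a+b)))

module _ {k : ℕ} where
  open DecMembership (_≟F_ {suc k}) using (_∈?_)

  arcEdges : ℕ → Fin (suc k) → List (Fin (suc k))
  arcEdges L u = applyUpTo (λ j → shift j u) L

  -- The worst case: only the edges of the arc are free.
  arcFaults : ℕ → Fin (suc k) → Subset (suc k)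
  arcFaults L u = tabulate (λ e → not (does (e ∈? arcEdges L u)))

  arcFaults-isArc : ∀ L (u : Fin (suc k)) → L < suc k → IsComponentArc (arcFaults L u) u L
  arcFaults-isArc L u L<n = record
    { L<n          = L<n
    ; free-inner   = free-inner
    ; faulty-left  = trans (lookup-arcFaults (prv u)) (cong not (dec-false (prv u ∈? arcEdges L u) prv-outside))
    ; faulty-right = trans (lookup-arcFaults (shift L u)) (cong not (dec-false (shift L u ∈? arcEdges L u) L-outside))
    }
    where
      lookup-arcFaults : ∀ e → lookup (arcFaults L u) e ≡ not (does (e ∈? arcEdges L u))
      lookup-arcFaults = VP.lookup∘tabulate _
      free-inner : ∀ j → j < L → lookup (arcFaults L u) (shift j u) ≡ false
      free-inner j j<L = trans (lookup-arcFaults (shift j u))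
        (cong not (dec-true (shift j u ∈? arcEdges L u) (MP.∈-applyUpTo⁺ (λ i → shift i u) j<L)))
      prv-outside : ¬ prv u ∈ arcEdges L u
      prv-outside ∈arc with MP.∈-applyUpTo⁻ (λ j → shift j u) {n = L} ∈arc
      ... | j , j<L , prv≡ with shift-injective (suc j) 0 u (NP.<-≤-trans (s≤s j<L) L<n) (s≤s z≤n)
                                  (trans (cong nxt (sym prv≡)) (nxt-prv u))
      ...   | ()
      L-outside : ¬ shift L u ∈ arcEdges L u
      L-outside ∈arc with MP.∈-applyUpTo⁻ (λ j → shift j u) {n = L} ∈arc
      ... | j , j<L , L≡ = NP.<-irrefl (sym (shift-injective L j u L<n (NP.<-trans j<L L<n) L≡)) j<L

-- The ratios

-- The arcs of a ring of size n: a + b < n, encoded with a : Fin n, b : Fin (n ∸ a).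
ArcsBounded : ℕ → Set
ArcsBounded n = ∀ (a : Fin n) (b : Fin (n ∸ toℕ a)) → ratio (ringCost n (toℕ a) (toℕ b)) (optArc (toℕ a) (toℕ b)) ≤ℚ claimedOverhead n

ArcAttains : ℕ → Set
ArcAttains n = Σ (Fin n) λ a → Σ (Fin (n ∸ toℕ a)) λ b → ratio (ringCost n (toℕ a) (toℕ b)) (optArc (toℕ a) (toℕ b)) ≡ claimedOverhead n

SmallRing : ℕ → Set
SmallRing n = 3 ≤ n → ArcsBounded n × (ratio (ringCostFaultFree n) (n ∸ 1) ≤ℚ claimedOverhead n) × ArcAttains n

small-ring? : ∀ n → Dec (SmallRing n)
small-ring? n = (3 NP.≤? n) →-dec
  ((FP.all? λ a → FP.all? λ b → ratio (ringCost n (toℕ a) (toℕ b)) (optArc (toℕ a) (toℕ b)) ℚP.≤? claimedOverhead n) ×-dec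
   (ratio (ringCostFaultFree n) (n ∸ 1) ℚP.≤? claimedOverhead n) ×-dec
   (FP.any? λ a → FP.any? λ b → ratio (ringCost n (toℕ a) (toℕ b)) (optArc (toℕ a) (toℕ b)) ℚP.≟ claimedOverhead n))

-- Rings of size below 24 are settled by evaluation.
small-rings : ∀ (n : Fin 24) → SmallRing (toℕ n)
small-rings = toWitness {a? = FP.all? λ n → small-ring? (toℕ n)} tt

small-ring : ∀ n → 3 ≤ n → n < 24 → ArcsBounded n × (ratio (ringCostFaultFree n) (n ∸ 1) ≤ℚ claimedOverhead n) × ArcAttains n
small-ring n 3≤n n<24 = subst SmallRing (FP.toℕ-fromℕ< n<24) (small-rings (Data.Fin.fromℕ< n<24)) 3≤n

arcsBounded⇒ : ∀ {n} → ArcsBounded n → ∀ a b → a + b < n → ratio (ringCost n a b) (optArc a b) ≤ℚ claimedOverhead n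
arcsBounded⇒ {n} bounded a b a+b<n =
  subst₂ (λ a′ b′ → ratio (ringCost n a′ b′) (optArc a′ b′) ≤ℚ claimedOverhead n) (FP.toℕ-fromℕ< a<n) (FP.toℕ-fromℕ< b<n∸a′)
    (bounded (Data.Fin.fromℕ< a<n) (Data.Fin.fromℕ< b<n∸a′))
  where
    a<n : a < n
    a<n = NP.≤-<-trans (NP.m≤m+n a b) a+b<n
    b<n∸a′ : b < n ∸ toℕ (Data.Fin.fromℕ< a<n)
    b<n∸a′ = subst (λ a′ → b < n ∸ a′) (sym (FP.toℕ-fromℕ< a<n))
               (NP.+-cancelˡ-< a b (n ∸ a) (subst (a + b <_) (sym (NP.m+[n∸m]≡n (NP.<⇒≤ a<n))) a+b<n))

arcAttains⇒ : ∀ {n} → ArcAttains n → Σ ℕ λ a → Σ ℕ λ b → (a + b < n) × (ratio (ringCost n a b) (optArc a b) ≡ claimedOverhead n)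
arcAttains⇒ {n} (a , b , eq) = toℕ a , toℕ b , a+b<n , eq
  where
    a+b<n : toℕ a + toℕ b < n
    a+b<n = subst (toℕ a + toℕ b <_) (NP.m+[n∸m]≡n (NP.<⇒≤ (FP.toℕ<n a))) (NP.+-monoʳ-< (toℕ a) (FP.toℕ<n b))

frac-≤-frac : ∀ a b c d → a * suc d ≤ c * suc b → frac a b ≤ℚ frac c d
frac-≤-frac a b c d h = ℚP.toℚᵘ-cancel-≤
  (UP.≤-respˡ-≃ (UP.≃-sym (ℚP.toℚᵘ-fromℚᵘ (U.mkℚᵘ (ℤ.+ a) b)))
  (UP.≤-respʳ-≃ (UP.≃-sym (ℚP.toℚᵘ-fromℚᵘ (U.mkℚᵘ (ℤ.+ c) d)))
  (U.*≤* (subst₂ ℤ._≤_ (ℤP.pos-* a (suc d)) (ℤP.pos-* c (suc b)) (+≤+ h)))))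

-- Junk value: ratio c 0 = 1, which is below p/(q+1) when q < p.
ratio≤frac : ∀ c m p q → q < p → c * suc q ≤ p * m → ratio c m ≤ℚ frac p q
ratio≤frac c zero    p q q<p _ = frac-≤-frac 1 0 p q (subst₂ _≤_ (sym (NP.*-identityˡ (suc q))) (sym (NP.*-identityʳ p)) q<p)
ratio≤frac c (suc m) p q _   h = frac-≤-frac c m p q h

claimedOverhead-large : ∀ t → claimedOverhead (24 + t) ≡ frac (47 + 2 * t) (25 + t)
claimedOverhead-large t = cong₂ frac (numerator t) (denominator t)
  where
    numerator : ∀ t → 23 + t + (24 + t + 0) ≡ 47 + 2 * t
    numerator = solve-∀
    denominator : ∀ t → 24 + t + 1 ≡ 25 + t
    denominator = solve-∀

≤-by-slack : ∀ {x y} s → y ≡ x + s → x ≤ y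
≤-by-slack {x} s refl = NP.m≤m+n x s

large-bound : ∀ t c m → c * (26 + t) ≤ (47 + 2 * t) * m → ratio c m ≤ℚ claimedOverhead (24 + t)
large-bound t c m h = subst (ratio c m ≤ℚ_) (sym (claimedOverhead-large t))
  (ratio≤frac c m (47 + 2 * t) (25 + t) (≤-by-slack (21 + t) (slack t)) h)
  where slack : ∀ t → 47 + 2 * t ≡ 26 + t + (21 + t)
        slack = solve-∀

large-bound-≤ : ∀ t c m → c ≤ m → ratio c m ≤ℚ claimedOverhead (24 + t)
large-bound-≤ t c m c≤m = large-bound t c m (begin
  c * (26 + t)         ≤⟨ NP.*-monoˡ-≤ (26 + t) c≤m ⟩
  m * (26 + t)         ≤⟨ NP.*-monoʳ-≤ m (≤-by-slack (21 + t) (slack t)) ⟩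
  m * (47 + 2 * t)     ≡⟨ NP.*-comm m _ ⟩
  (47 + 2 * t) * m     ∎)
  where
    open NP.≤-Reasoning
    slack : ∀ t → 47 + 2 * t ≡ 26 + t + (21 + t)
    slack = solve-∀

-- With κ = 2, the cost is 4 + a + 2b against the optimum a + b + min(a, b) once a ≥ 3.
large-arc : ∀ t a b → a + b < 24 + t → ratio (ringCost (24 + t) a b) (optArc a b) ≤ℚ claimedOverhead (24 + t)
large-arc t zero          b             _ = large-bound-≤ t b (b + 0) (NP.m≤m+n b 0)
large-arc t (suc a)       zero          _ =
  large-bound-≤ t (suc a) (suc a + 0 + 0) (NP.≤-trans (NP.m≤m+n (suc a) 0) (NP.m≤m+n (suc a + 0) 0))
large-arc t (suc zero)    (suc b)       _ = large-bound-≤ t _ _ (NP.≤-reflexive (equal b))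
  where equal : ∀ b → 1 + (1 + suc b) ≡ 1 + suc b + 1
        equal = solve-∀
large-arc t (suc (suc zero)) (suc zero) _ = large-bound t 5 4 (≤-by-slack (58 + 3 * t) (slack t))
  where slack : ∀ t → (47 + 2 * t) * 4 ≡ 5 * (26 + t) + (58 + 3 * t)
        slack = solve-∀
large-arc t (suc (suc zero)) (suc (suc b)) _ = large-bound-≤ t _ _ (NP.≤-reflexive (equal b))
  where equal : ∀ b → 2 + (2 + suc (suc b)) ≡ 2 + suc (suc b) + 2
        equal = solve-∀
large-arc t (suc (suc (suc x))) (suc b) a+b<n with suc b NP.≤? 3 + x
... | yes b≤a = subst (λ m → ratio ((2 + (2 + suc b)) + ((3 + x) + suc b)) m ≤ℚ claimedOverhead (24 + t)) (sym opt≡)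
      (large-bound t ((2 + (2 + suc b)) + ((3 + x) + suc b)) (5 + w) (≤-by-slack (1 + 21 * w + t + t * w) (slack t x b)))
  where
    w = x + b + b
    opt≡ : optArc (3 + x) (suc b) ≡ 5 + w
    opt≡ = trans (cong (3 + x + suc b +_) (NP.m≥n⇒m⊓n≡n b≤a)) (opt x b)
      where opt : ∀ x b → 3 + x + suc b + suc b ≡ 5 + (x + b + b)
            opt = solve-∀
    slack : ∀ t x b → (47 + 2 * t) * (5 + (x + b + b)) ≡
            ((2 + (2 + suc b)) + ((3 + x) + suc b)) * (26 + t) + (1 + 21 * (x + b + b) + t + t * (x + b + b))
    slack = solve-∀
... | no  b≰a = subst (λ m → ratio ((2 + (2 + suc b)) + ((3 + x) + suc b)) m ≤ℚ claimedOverhead (24 + t)) (sym opt≡)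
      (large-bound t ((2 + (2 + suc b)) + ((3 + x) + suc b)) (3 + x + suc b + (3 + x)) bound)
  where
    y = b ∸ (3 + x)
    1+b≡ : suc b ≡ 4 + x + y
    1+b≡ = cong suc (sym (NP.m+[n∸m]≡n (s≤s⁻¹ (NP.≰⇒> b≰a))))
    e = 23 + t ∸ (3 + x + suc b)
    n₀≡ : 23 + t ≡ 3 + x + suc b + e
    n₀≡ = sym (NP.m+[n∸m]≡n (s≤s⁻¹ a+b<n))
    opt≡ : optArc (3 + x) (suc b) ≡ 3 + x + suc b + (3 + x)
    opt≡ = cong (3 + x + suc b +_) (NP.m≤n⇒m⊓n≡m (NP.<⇒≤ (NP.≰⇒> b≰a)))
    Bound : ℕ → ℕ → Set
    Bound B n₀ = ((2 + (2 + B)) + ((3 + x) + B)) * (n₀ + 3) ≤ (2 * n₀ + 1) * (3 + x + B + (3 + x))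
    slack : ∀ x y e → let B = 4 + x + y ; n₀ = 3 + x + B + e in
            (2 * n₀ + 1) * (3 + x + B + (3 + x)) ≡
            ((2 + (2 + B)) + ((3 + x) + B)) * (n₀ + 3) + (25 * x + 5 * e + 6 * x * x + 3 * x * y + 3 * x * e)
    slack = solve-∀
    bound′ : Bound (suc b) (23 + t)
    bound′ = subst₂ Bound (sym 1+b≡) (sym (trans n₀≡ (cong (λ B → 3 + x + B + e) 1+b≡)))
               (≤-by-slack _ (slack x y e))
    bound : ((2 + (2 + suc b)) + ((3 + x) + suc b)) * (26 + t) ≤ (47 + 2 * t) * (3 + x + suc b + (3 + x))
    bound = subst₂ (λ p q → ((2 + (2 + suc b)) + ((3 + x) + suc b)) * p ≤ q * (3 + x + suc b + (3 + x)))
              {23 + t + 3} {26 + t} {2 * (23 + t) + 1} {47 + 2 * t} (three t) (one t) bound′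
      where three : ∀ t → 23 + t + 3 ≡ 26 + t
            three = solve-∀
            one : ∀ t → 2 * (23 + t) + 1 ≡ 47 + 2 * t
            one = solve-∀

large-fault-free : ∀ t → ratio (ringCostFaultFree (24 + t)) (23 + t) ≤ℚ claimedOverhead (24 + t)
large-fault-free t = large-bound t (2 + (23 + t)) (23 + t) (≤-by-slack (431 + 42 * t + t * t) (slack t))
  where slack : ∀ t → (47 + 2 * t) * (23 + t) ≡ (2 + (23 + t)) * (26 + t) + (431 + 42 * t + t * t)
        slack = solve-∀

large-attains : ∀ t → ratio (ringCost (24 + t) 3 (20 + t)) (optArc 3 (20 + t)) ≡ claimedOverhead (24 + t)
large-attains t = trans (cong₂ ratio (cost t) (opt t)) (sym (claimedOverhead-large t))
  where
    cost : ∀ t → (2 + (2 + (20 + t))) + (3 + (20 + t)) ≡ 47 + 2 * t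
    cost = solve-∀
    opt : ∀ t → 3 + (20 + t) + 3 ≡ 26 + t
    opt = solve-∀

at-least-24 : ∀ {P : ℕ → Set} → (∀ t → P (24 + t)) → ∀ n → ¬ n < 24 → P n
at-least-24 {P} P-large n n≮24 = subst P (NP.m+[n∸m]≡n (NP.≮⇒≥ n≮24)) (P-large (n ∸ 24))

ratio-ringCost-≤ : ∀ n a b → 3 ≤ n → a + b < n → ratio (ringCost n a b) (optArc a b) ≤ℚ claimedOverhead n
ratio-ringCost-≤ n a b 3≤n with n NP.<? 24
... | yes n<24 = arcsBounded⇒ (proj₁ (small-ring n 3≤n n<24)) a b
... | no  n≮24 = at-least-24 {λ n → a + b < n → ratio (ringCost n a b) (optArc a b) ≤ℚ claimedOverhead n} (λ t → large-arc t a b) n n≮24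

ratio-ringCostFaultFree-≤ : ∀ n → 3 ≤ n → ratio (ringCostFaultFree n) (n ∸ 1) ≤ℚ claimedOverhead n
ratio-ringCostFaultFree-≤ n 3≤n with n NP.<? 24
... | yes n<24 = proj₁ (proj₂ (small-ring n 3≤n n<24))
... | no  n≮24 = at-least-24 {λ n → ratio (ringCostFaultFree n) (n ∸ 1) ≤ℚ claimedOverhead n} large-fault-free n n≮24

ratio-ringCost-attained : ∀ n → 3 ≤ n → Σ ℕ λ a → Σ ℕ λ b → (a + b < n) × (ratio (ringCost n a b) (optArc a b) ≡ claimedOverhead n)
ratio-ringCost-attained n 3≤n with n NP.<? 24
... | yes n<24 = arcAttains⇒ (proj₂ (proj₂ (small-ring n 3≤n n<24)))
... | no  n≮24 = at-least-24 {λ n → Σ ℕ λ a → Σ ℕ λ b → (a + b < n) × (ratio (ringCost n a b) (optArc a b) ≡ claimedOverhead n)}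
                   (λ t → 3 , 20 + t , NP.≤-refl , large-attains t) n n≮24

cost-and-opt-arc : ∀ {k} → 1 < suc k → ∀ {F : Subset (suc k)} {v} a b → a ≤ k → IsComponentArc F (back a v) (a + b) →
                   IsRingCost F v (ringCost (suc k) a b) × IsOpt F v (optArc a b)
cost-and-opt-arc 1<n {F} {v} a b a≤k arc =
  subst (λ w → IsRingCost F w (ringCost (suc _) a b)) (shift-back a v a≤k) (ArcRun.isRingCost-arc 1<n a b arc) ,
  subst (λ w → IsOpt F w (optArc a b)) (shift-back a v a≤k) (Arc.isOpt a b arc)

cost-and-opt-fault-free : ∀ {k′} (F : Subset (suc (suc k′))) v → FaultFree F →
                          IsRingCost F v (ringCostFaultFree (suc (suc k′))) × IsOpt F v (suc k′)
cost-and-opt-fault-free {k′} F v fault-free = by-size (suc (suc k′) ≤ᵇ 5) refl , FaultFreeRing.isOpt F v fault-free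
  where
    from : ∀ s → s ≤ suc k′ → ∀ {c} → IsRingCost F (shift s (back s v)) c → IsRingCost F v c
    from s s≤k {c} = subst (λ w → IsRingCost F w c) (shift-back s v s≤k)
    by-size : ∀ x → (suc (suc k′) ≤ᵇ 5) ≡ x → IsRingCost F v (ringCostFaultFree (suc (suc k′)))
    by-size true  small = subst (IsRingCost F v) (sym (if-true {b = suc (suc k′) ≤ᵇ 5} {suc k′} {probe (suc (suc k′)) + suc k′} small))
      (from (suc k′) NP.≤-refl (FaultFreeRun.cost-small F (back (suc k′) v) fault-free small))
    by-size false large = subst (IsRingCost F v) (sym (if-false {b = suc (suc k′) ≤ᵇ 5} {suc k′} {probe (suc (suc k′)) + suc k′} large))
      (from (probe (suc (suc k′))) (NP.<⇒≤ (probe<n∸1 (suc k′) large)) (FaultFreeRun.cost-large F (back (probe (suc (suc k′))) v) fault-free large))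

proposition2p1 : (n : ℕ) → 3 ≤ n → (v : Fin n) → RingOverheadIs n v (claimedOverhead n)
proposition2p1 n@(suc (suc (suc m))) 3≤n@(s≤s (s≤s (s≤s _))) v =
  (λ F → [ fault-free-case F , arc-case F ]′ (component-of F v)) ,
  worst-case (ratio-ringCost-attained n 3≤n)
  where
    1<n : 1 < n
    1<n = s≤s (s≤s z≤n)
    Witness : Subset n → (ℚ → Set) → Set
    Witness F P = Σ ℕ λ c → Σ ℕ λ opt → IsRingCost F v c × IsOpt F v opt × P (ratio c opt)
    fault-free-case : ∀ F → FaultFree F → Witness F (_≤ℚ claimedOverhead n)
    fault-free-case F fault-free = ringCostFaultFree n , n ∸ 1 , proj₁ cost-opt , proj₂ cost-opt ,
                                   ratio-ringCostFaultFree-≤ n 3≤n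
      where cost-opt = cost-and-opt-fault-free F v fault-free
    arc-case : ∀ F → ArcAround F v → Witness F (_≤ℚ claimedOverhead n)
    arc-case F around = ringCost n a b , optArc a b , proj₁ cost-opt , proj₂ cost-opt ,
                        ratio-ringCost-≤ n a b 3≤n (IsComponentArc.L<n isArc)
      where open ArcAround around
            cost-opt = cost-and-opt-arc 1<n a b a≤k isArc
    worst-case : (Σ ℕ λ a → Σ ℕ λ b → (a + b < n) × (ratio (ringCost n a b) (optArc a b) ≡ claimedOverhead n)) →
                 Σ (Subset n) λ F → Witness F (_≡ claimedOverhead n)
    worst-case (a , b , a+b<n , attained) = arcFaults (a + b) (back a v) ,
      ringCost n a b , optArc a b , proj₁ cost-opt , proj₂ cost-opt , attained
      where cost-opt = cost-and-opt-arc 1<n a b (s≤s⁻¹ (NP.≤-<-trans (NP.m≤m+n a b) a+b<n))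
                         (arcFaults-isArc (a + b) (back a v) a+b<n)
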